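{- For integers $n, m, d \geqslant 0$, let $\mathfrak{B}_{n,m,d}$ be the set of inversion sequences of length $n$ that avoid the pattern $010$, have maximum value $m$, and contain exactly $d$ distinct values, and let $\mathfrak{b}_{n,m,d} = \#\mathfrak{B}_{n,m,d}$. Then the number of $010$-avoiding inversion sequences of length $n \geqslant 1$ is $\sum_{m=0}^{n-1}\sum_{d=0}^{n} \mathfrak{b}_{n,m,d}$, and for all $n \geqslant 0$, $m \geqslant 1$, $d \geqslant 0$, $$\mathfrak{b}_{n,m,d} = \sum_{i = 0}^{d-1} \binom{m-i}{d-i-1} \sum_{p = m+1}^n \left[ {n-p+1 \atop n-p-d+i+2} \right] \sum_{j = 0}^{m-1} \mathfrak{b}_{p-1,j,i},$$ where $\left[ {a \atop b} \right]$ denotes the unsigned Stirling number of the first kind.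
   Context: An inversion sequence of length $n$ is a sequence $\sigma=(\sigma_1,\dots,\sigma_n)$ of nonnegative integers with $0\leqslant \sigma_i < i$ for all $i$. A sequence $\sigma$ contains a pattern $p=(p_1,\dots,p_k)$ if some subsequence $(\sigma_{i_1},\dots,\sigma_{i_k})$ with $i_1<\dots<i_k$ is order-isomorphic to $p$; otherwise it avoids $p$. Avoiding $010$ means there are no indices $a<b<c$ with $\sigma_a=\sigma_c<\sigma_b$. The unsigned Stirling number of the first kind $\left[ {n \atop j} \right]$ counts permutations of $n$ elements with exactly $j$ cycles, with $\left[ {n \atop j} \right]=0$ for $n\geqslant1$, $j\leqslant 0$. Binomial coefficients $\binom{a}{b}$ are $0$ when $b>a$. -}

module Defs where

open import Data.Nat using (ℕ; zero; suc; _+_; _*_; _∸_; _≤_; _<_; _≟_; _≤?_; _<?_)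
open import Data.Nat.Combinatorics using (_C_)
open import Data.Fin using (Fin; toℕ)
import Data.Fin as F
open import Data.Fin.Properties using (all?; any?)
open import Data.Vec using (Vec; []; _∷_; lookup; toList)
open import Data.List using (List; []; _∷_; [_]; map; concatMap; upTo; length; filter; deduplicate)
open import Data.Nat.ListAction using (sum)
open import Data.Product using (Σ; ∃; _×_; _,_)
open import Relation.Nullary using (¬_; Dec; ¬?)
open import Relation.Nullary.Decidable using (_×-dec_)
open import Relation.Binary.PropositionalEquality using (_≡_)

sumLt : ℕ → (ℕ → ℕ) → ℕ
sumLt n f = sum (map f (upTo n))

-- sumFromTo a b f = Σ_{k=a}^{b} f k  (empty, i.e. 0, when b < a)
sumFromTo : ℕ → ℕ → (ℕ → ℕ) → ℕ
sumFromTo a b f = sum (map (λ k → f (a + k)) (upTo (suc b ∸ a)))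

stirling1 : ℕ → ℕ → ℕ
stirling1 zero    zero    = 1
stirling1 zero    (suc k) = 0
stirling1 (suc n) zero    = 0
stirling1 (suc n) (suc k) = n * stirling1 n (suc k) + stirling1 n k

-- Sequences (σ_1,…,σ_n) are represented as Vec ℕ n, 0-indexed:
-- position i : Fin n corresponds to the paper's index i+1.

IsInvSeq : ∀ {n} → Vec ℕ n → Set
IsInvSeq {n} σ = (i : Fin n) → lookup σ i < suc (toℕ i)

Contains010 : ∀ {n} → Vec ℕ n → Set
Contains010 {n} σ =
  ∃ λ (a : Fin n) → ∃ λ (b : Fin n) → ∃ λ (c : Fin n) →
    (a F.< b) × (b F.< c) × (lookup σ a ≡ lookup σ c) × (lookup σ a < lookup σ b)

Avoids010 : ∀ {n} → Vec ℕ n → Set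
Avoids010 σ = ¬ Contains010 σ

HasMax : ∀ {n} → ℕ → Vec ℕ n → Set
HasMax {n} m σ = ((i : Fin n) → lookup σ i ≤ m) × (∃ λ (i : Fin n) → lookup σ i ≡ m)

distinctValues : ∀ {n} → Vec ℕ n → ℕ
distinctValues σ = length (deduplicate _≟_ (toList σ))

isInvSeq? : ∀ {n} (σ : Vec ℕ n) → Dec (IsInvSeq σ)
isInvSeq? σ = all? (λ i → lookup σ i <? suc (toℕ i))

contains010? : ∀ {n} (σ : Vec ℕ n) → Dec (Contains010 σ)
contains010? σ = any? λ a → any? λ b → any? λ c →
  (a F.<? b) ×-dec ((b F.<? c) ×-dec ((lookup σ a ≟ lookup σ c) ×-dec (lookup σ a <? lookup σ b)))

avoids010? : ∀ {n} (σ : Vec ℕ n) → Dec (Avoids010 σ)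
avoids010? σ = ¬? (contains010? σ)

hasMax? : ∀ {n} (m : ℕ) (σ : Vec ℕ n) → Dec (HasMax m σ)
hasMax? m σ = all? (λ i → lookup σ i ≤? m) ×-dec any? (λ i → lookup σ i ≟ m)

allVecs : (n k : ℕ) → List (Vec ℕ n)
allVecs zero    k = [ [] ]
allVecs (suc n) k = concatMap (λ x → map (x ∷_) (allVecs n k)) (upTo k)

-- Every inversion sequence of length n has entries < n, so allVecs n n
-- contains each of them exactly once.

InB : (n m d : ℕ) → Vec ℕ n → Set
InB n m d σ = IsInvSeq σ × Avoids010 σ × HasMax m σ × (distinctValues σ ≡ d)

inB? : (n m d : ℕ) (σ : Vec ℕ n) → Dec (InB n m d σ)
inB? n m d σ = isInvSeq? σ ×-dec (avoids010? σ ×-dec (hasMax? m σ ×-dec (distinctValues σ ≟ d)))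

b : ℕ → ℕ → ℕ → ℕ
b n m d = length (filter (inB? n m d) (allVecs n n))

avoidCount : ℕ → ℕ
avoidCount n = length (filter (λ σ → isInvSeq? σ ×-dec avoids010? σ) (allVecs n n))

-- Cut σ ∈ 𝔅_{n,m,d} at the first occurrence of its maximum m, at position p: σ = u · m · β.
-- Avoiding 010 forces u and β to share no value, so u is a 010-avoiding inversion sequence of
-- length p − 1 with maximum j < m and some number i of distinct values, and β is a word over m and
-- the m − i values below m missing from u, such that m · β avoids 010 and has d − i distinct values;
-- the inversion condition on β is automatic since p > m. Removing the least available letter x,
-- whose occurrences in such a tail form one block, shows that these tails are counted by
-- C(m − i, d − i − 1) · [n − p + 1, n − p − d + i + 2]: the binomial factor obeys Pascal's rule and
-- the other the recurrence of Stirling numbers of the first kind. All counts are sums of 0/1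
-- indicators over the words of a given length over {0, …, k − 1}.

module Submission where

open import Defs
open import Data.Nat using (ℕ; zero; suc; _+_; _*_; _∸_; _≤_; _<_; _≟_; _≤?_; _<?_; z≤n; s≤s; _⊔_)
open import Data.Nat.Properties
open import Data.Nat.Combinatorics using (_C_; nCk+nC[k+1]≡[n+1]C[k+1])
open import Data.Nat.ListAction using (sum)
open import Data.Nat.Solver using (module +-*-Solver)
open import Data.Fin using (toℕ) renaming (zero to fzero; suc to fsuc)
import Data.Fin as Fin
open import Data.Vec using (Vec; lookup; toList) renaming ([] to []ᵥ; _∷_ to _∷ᵥ_)
open import Data.Vec.Membership.Propositional.Properties using (∈-lookup; ∈-toList⁺; ∈-toList⁻)
open import Data.Vec.Relation.Unary.Any using (index)
open import Data.Vec.Relation.Unary.Any.Properties using (lookup-index)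
open import Data.List using (List; []; _∷_; [_]; map; concatMap; upTo; length; filter; _++_; deduplicate)
open import Data.List.Properties using (map-upTo; upTo-∷ʳ; length-upTo; filter-accept; filter-reject)
open import Data.List.Membership.Propositional using (_∈_; _∉_; find; lose)
open import Data.List.Membership.DecPropositional _≟_ using (_∈?_)
open import Data.List.Membership.Propositional.Properties
  using (∈-upTo⁻; ∈-map⁻; ∈-concatMap⁻; ∈-++⁺ˡ; ∈-++⁺ʳ; ∈-++⁻; ∈-deduplicate⁻; ∈-deduplicate⁺)
open import Data.List.Relation.Unary.Any as Any using (Any; here; there; any?)
open import Data.List.Relation.Unary.All as All using (All; []; _∷_; all?)
import Data.List.Relation.Unary.All.Properties as All
open import Data.List.Relation.Unary.AllPairs using ([]; _∷_)
open import Data.List.Relation.Unary.Unique.Propositional using (Unique)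
open import Data.List.Relation.Unary.Unique.DecPropositional.Properties _≟_ using (deduplicate-!)
open import Data.List.Relation.Binary.Sublist.DecPropositional _≟_
  using (_⊆_; _⊆?_; []; _∷_; _∷ʳ_; ⊆-refl; ⊆-trans; to∈; from∈)
open import Data.List.Relation.Binary.Sublist.Propositional.Properties using (∷ˡ⁻; ++⁺; ++⁺ˡ; ++⁺ʳ)
open import Data.Product using (∃; ∃₂; _×_; _,_; proj₁; proj₂)
open import Data.Sum using (_⊎_; inj₁; inj₂; [_,_]′)
open import Data.Unit using (⊤; tt)
open import Data.Empty using (⊥-elim)
open import Relation.Nullary using (¬_; Dec; yes; no; ¬?)
open import Relation.Nullary.Decidable using (_×-dec_; _⊎-dec_)
open import Relation.Binary.PropositionalEquality hiding ([_])
open import Function using (_∘_; _⇔_; mk⇔; Equivalence)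
open import Algebra.Properties.CommutativeSemigroup +-commutativeSemigroup using () renaming (interchange to +-interchange)
open import Algebra.Properties.CommutativeSemigroup *-commutativeSemigroup
  using () renaming (interchange to *-interchange; x∙yz≈y∙xz to *-left-comm)

-- Finite sums and indicators

∑ : {A : Set} → List A → (A → ℕ) → ℕ
∑ xs f = sum (map f xs)

infix 5 ∑
syntax ∑ xs (λ x → e) = ∑[ x ← xs ] e

module _ {A : Set} where

  ∑-++ : (xs ys : List A) (f : A → ℕ) → ∑ (xs ++ ys) f ≡ ∑ xs f + ∑ ys f
  ∑-++ []       ys f = refl
  ∑-++ (x ∷ xs) ys f = trans (cong (f x +_) (∑-++ xs ys f)) (sym (+-assoc (f x) _ _))

  ∑-cong : (xs : List A) {f g : A → ℕ} → (∀ x → f x ≡ g x) → ∑ xs f ≡ ∑ xs g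
  ∑-cong []       f≗g = refl
  ∑-cong (x ∷ xs) f≗g = cong₂ _+_ (f≗g x) (∑-cong xs f≗g)

  ∑-cong-∈ : (xs : List A) {f g : A → ℕ} → (∀ x → x ∈ xs → f x ≡ g x) → ∑ xs f ≡ ∑ xs g
  ∑-cong-∈ []       f≗g = refl
  ∑-cong-∈ (x ∷ xs) f≗g = cong₂ _+_ (f≗g x (here refl)) (∑-cong-∈ xs (λ y y∈ → f≗g y (there y∈)))

  ∑-zero-∈ : (xs : List A) {f : A → ℕ} → (∀ x → x ∈ xs → f x ≡ 0) → ∑ xs f ≡ 0
  ∑-zero-∈ []       f≗0 = refl
  ∑-zero-∈ (x ∷ xs) f≗0 rewrite f≗0 x (here refl) = ∑-zero-∈ xs (λ y y∈ → f≗0 y (there y∈))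

  ∑-zero : (xs : List A) {f : A → ℕ} → (∀ x → f x ≡ 0) → ∑ xs f ≡ 0
  ∑-zero xs f≗0 = ∑-zero-∈ xs (λ x _ → f≗0 x)

  ∑-distrib-+ : (xs : List A) (f g : A → ℕ) → ∑[ x ← xs ] (f x + g x) ≡ ∑ xs f + ∑ xs g
  ∑-distrib-+ []       f g = refl
  ∑-distrib-+ (x ∷ xs) f g rewrite ∑-distrib-+ xs f g = +-interchange (f x) (g x) (∑ xs f) (∑ xs g)

  ∑-*ˡ : (xs : List A) (c : ℕ) (f : A → ℕ) → ∑[ x ← xs ] (c * f x) ≡ c * ∑ xs f
  ∑-*ˡ []       c f = sym (*-zeroʳ c)
  ∑-*ˡ (x ∷ xs) c f rewrite ∑-*ˡ xs c f = sym (*-distribˡ-+ c (f x) (∑ xs f))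

  ∑-*ʳ : (xs : List A) (c : ℕ) (f : A → ℕ) → ∑[ x ← xs ] (f x * c) ≡ ∑ xs f * c
  ∑-*ʳ xs c f = trans (∑-cong xs (λ x → *-comm (f x) c)) (trans (∑-*ˡ xs c f) (*-comm c _))

  ∑-const : (xs : List A) (c : ℕ) → ∑[ _ ← xs ] c ≡ length xs * c
  ∑-const []       c = refl
  ∑-const (x ∷ xs) c = cong (c +_) (∑-const xs c)

module _ {A B : Set} where

  ∑-map : (h : A → B) (xs : List A) (f : B → ℕ) → ∑ (map h xs) f ≡ ∑[ x ← xs ] f (h x)
  ∑-map h []       f = refl
  ∑-map h (x ∷ xs) f = cong (f (h x) +_) (∑-map h xs f)

  ∑-concatMap : (g : A → List B) (xs : List A) (f : B → ℕ) →
                ∑ (concatMap g xs) f ≡ ∑[ x ← xs ] ∑ (g x) f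
  ∑-concatMap g []       f = refl
  ∑-concatMap g (x ∷ xs) f = trans (∑-++ (g x) (concatMap g xs) f) (cong (∑ (g x) f +_) (∑-concatMap g xs f))

  ∑-comm : (xs : List A) (ys : List B) (f : A → B → ℕ) →
           ∑[ x ← xs ] ∑[ y ← ys ] f x y ≡ ∑[ y ← ys ] ∑[ x ← xs ] f x y
  ∑-comm []       ys f = sym (∑-zero ys (λ _ → refl))
  ∑-comm (x ∷ xs) ys f = trans (cong (∑ ys (f x) +_) (∑-comm xs ys f))
                               (sym (∑-distrib-+ ys (f x) (λ y → ∑[ x′ ← xs ] f x′ y)))

∑-upTo-suc : ∀ n (f : ℕ → ℕ) → ∑ (upTo (suc n)) f ≡ f 0 + (∑[ i ← upTo n ] f (suc i))
∑-upTo-suc n f = cong (f 0 +_) (trans (cong (λ is → ∑ is f) (sym (map-upTo suc n))) (∑-map suc (upTo n) f))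

∑-upTo-snoc : ∀ n (f : ℕ → ℕ) → ∑ (upTo (suc n)) f ≡ ∑ (upTo n) f + f n
∑-upTo-snoc n f = begin
  ∑ (upTo (suc n)) f         ≡⟨ cong (λ is → ∑ is f) (upTo-∷ʳ n) ⟨
  ∑ (upTo n ++ [ n ]) f      ≡⟨ ∑-++ (upTo n) [ n ] f ⟩
  ∑ (upTo n) f + (f n + 0)   ≡⟨ cong (∑ (upTo n) f +_) (+-identityʳ (f n)) ⟩
  ∑ (upTo n) f + f n         ∎
  where open ≡-Reasoning

∑-upTo-+ : ∀ a b (f : ℕ → ℕ) → ∑ (upTo (a + b)) f ≡ ∑ (upTo a) f + (∑[ i ← upTo b ] f (a + i))
∑-upTo-+ zero    b f = refl
∑-upTo-+ (suc a) b f = begin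
  ∑ (upTo (suc (a + b))) f                                                ≡⟨ ∑-upTo-suc (a + b) f ⟩
  f 0 + (∑[ i ← upTo (a + b) ] f (suc i))                                 ≡⟨ cong (f 0 +_) (∑-upTo-+ a b (f ∘ suc)) ⟩
  f 0 + ((∑[ i ← upTo a ] f (suc i)) + (∑[ i ← upTo b ] f (suc (a + i)))) ≡⟨ +-assoc (f 0) _ _ ⟨
  f 0 + (∑[ i ← upTo a ] f (suc i)) + (∑[ i ← upTo b ] f (suc (a + i)))   ≡⟨ cong (_+ rest) (∑-upTo-suc a f) ⟨
  ∑ (upTo (suc a)) f + rest                                               ∎
  where
  open ≡-Reasoning
  rest = ∑[ i ← upTo b ] f (suc a + i)

𝟙 : {P : Set} → Dec P → ℕ
𝟙 (yes _) = 1
𝟙 (no _)  = 0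

module _ {P : Set} where

  𝟙-yes : (p : Dec P) → P → 𝟙 p ≡ 1
  𝟙-yes (yes _) _ = refl
  𝟙-yes (no ¬p) p = ⊥-elim (¬p p)

  𝟙-no : (p : Dec P) → ¬ P → 𝟙 p ≡ 0
  𝟙-no (yes p) ¬p = ⊥-elim (¬p p)
  𝟙-no (no _)  _  = refl

  𝟙≤1 : (p : Dec P) → 𝟙 p ≤ 1
  𝟙≤1 (yes _) = s≤s z≤n
  𝟙≤1 (no _)  = z≤n

  𝟙-¬ : (p : Dec P) → 𝟙 (¬? p) + 𝟙 p ≡ 1
  𝟙-¬ (yes _) = refl
  𝟙-¬ (no _)  = refl

  𝟙-*-cong : (p : Dec P) {x y : ℕ} → (P → x ≡ y) → 𝟙 p * x ≡ 𝟙 p * y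
  𝟙-*-cong (yes p) x≡y = cong (1 *_) (x≡y p)
  𝟙-*-cong (no _)  _   = refl

  module _ {Q : Set} where

    𝟙-cong : P ⇔ Q → (p : Dec P) (q : Dec Q) → 𝟙 p ≡ 𝟙 q
    𝟙-cong P⇔Q (yes p) (yes q) = refl
    𝟙-cong P⇔Q (yes p) (no ¬q) = ⊥-elim (¬q (Equivalence.to P⇔Q p))
    𝟙-cong P⇔Q (no ¬p) (yes q) = ⊥-elim (¬p (Equivalence.from P⇔Q q))
    𝟙-cong P⇔Q (no ¬p) (no ¬q) = refl

    𝟙-× : (p : Dec P) (q : Dec Q) → 𝟙 (p ×-dec q) ≡ 𝟙 p * 𝟙 q
    𝟙-× (yes _) (yes _) = refl
    𝟙-× (yes _) (no _)  = refl
    𝟙-× (no _)  (yes _) = refl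
    𝟙-× (no _)  (no _)  = refl

length-filter≡∑𝟙 : {A : Set} {P : A → Set} (P? : (x : A) → Dec (P x)) (xs : List A) →
                   length (filter P? xs) ≡ ∑[ x ← xs ] 𝟙 (P? x)
length-filter≡∑𝟙 P? [] = refl
length-filter≡∑𝟙 P? (x ∷ xs) with P? x
... | yes _ = cong suc (length-filter≡∑𝟙 P? xs)
... | no _  = length-filter≡∑𝟙 P? xs

∑-δ-out : ∀ n c (f : ℕ → ℕ) → n ≤ c → ∑[ i ← upTo n ] (𝟙 (i ≟ c) * f i) ≡ 0
∑-δ-out n c f n≤c = ∑-zero-∈ (upTo n) (λ i i∈ → cong (_* f i) (𝟙-no (i ≟ c) (λ { refl → <⇒≱ (∈-upTo⁻ i∈) n≤c })))

∑-δ : ∀ n c (f : ℕ → ℕ) → c < n → ∑[ i ← upTo n ] (𝟙 (i ≟ c) * f i) ≡ f c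
∑-δ (suc n) c f c<1+n with c ≟ n
... | yes refl = begin
  ∑[ i ← upTo (suc n) ] (𝟙 (i ≟ n) * f i)
    ≡⟨ ∑-upTo-snoc n _ ⟩
  (∑[ i ← upTo n ] (𝟙 (i ≟ n) * f i)) + 𝟙 (n ≟ n) * f n
    ≡⟨ cong₂ _+_ (∑-δ-out n n f ≤-refl) (cong (_* f n) (𝟙-yes (n ≟ n) refl)) ⟩
  f n + 0
    ≡⟨ +-identityʳ (f n) ⟩
  f n
    ∎
  where open ≡-Reasoning
... | no c≢n = begin
  ∑[ i ← upTo (suc n) ] (𝟙 (i ≟ c) * f i)
    ≡⟨ ∑-upTo-snoc n _ ⟩
  (∑[ i ← upTo n ] (𝟙 (i ≟ c) * f i)) + 𝟙 (n ≟ c) * f n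
    ≡⟨ cong₂ _+_ (∑-δ n c f (≤∧≢⇒< (≤-pred c<1+n) c≢n)) (cong (_* f n) (𝟙-no (n ≟ c) (c≢n ∘ sym))) ⟩
  f c + 0
    ≡⟨ +-identityʳ (f c) ⟩
  f c
    ∎
  where open ≡-Reasoning

∑-δ-∸ : ∀ d c y → 1 ≤ y → ∑[ i ← upTo d ] (𝟙 (i ≟ c) * 𝟙 (y ≟ d ∸ i)) ≡ 𝟙 (c + y ≟ d)
∑-δ-∸ d c y 1≤y with c <? d
... | yes c<d = trans (∑-δ d c (λ i → 𝟙 (y ≟ d ∸ i)) c<d)
                      (𝟙-cong (mk⇔ (λ y≡d∸c → trans (cong (c +_) y≡d∸c) (m+[n∸m]≡n (<⇒≤ c<d)))
                                   (λ c+y≡d → trans (sym (m+n∸m≡n c y)) (cong (_∸ c) c+y≡d))) _ _)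
... | no c≮d  = trans (∑-δ-out d c _ (≮⇒≥ c≮d))
                      (sym (𝟙-no (c + y ≟ d) (λ c+y≡d → <-irrefl (sym c+y≡d) (≤-<-trans (≮⇒≥ c≮d) (m<m+n c 1≤y)))))

-- Words of length n over {0, …, k − 1}

words : ℕ → ℕ → List (List ℕ)
words zero    k = [ [] ]
words (suc n) k = concatMap (λ y → map (y ∷_) (words n k)) (upTo k)

∈-words⁻ : ∀ n k {w} → w ∈ words n k → length w ≡ n × All (_< k) w
∈-words⁻ zero    k (here refl) = refl , []
∈-words⁻ (suc n) k w∈ with find (∈-concatMap⁻ (λ y → map (y ∷_) (words n k)) {xs = upTo k} w∈)
... | y , y∈ , yw∈ with ∈-map⁻ (y ∷_) yw∈
...   | w , w∈ , refl with ∈-words⁻ n k w∈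
...     | refl , w<k = refl , ∈-upTo⁻ y∈ ∷ w<k

∑-words-suc : ∀ n k (f : List ℕ → ℕ) → ∑ (words (suc n) k) f ≡ ∑[ y ← upTo k ] ∑[ w ← words n k ] f (y ∷ w)
∑-words-suc n k f = trans (∑-concatMap (λ y → map (y ∷_) (words n k)) (upTo k) f)
                          (∑-cong (upTo k) (λ y → ∑-map (y ∷_) (words n k) f))

∑-allVecs : ∀ n k (f : List ℕ → ℕ) → ∑[ σ ← allVecs n k ] f (toList σ) ≡ ∑ (words n k) f
∑-allVecs zero    k f = refl
∑-allVecs (suc n) k f = begin
  ∑[ σ ← allVecs (suc n) k ] f (toList σ)                          ≡⟨ ∑-concatMap _ (upTo k) _ ⟩
  ∑[ y ← upTo k ] ∑[ σ ← map (y ∷ᵥ_) (allVecs n k) ] f (toList σ) ≡⟨ ∑-cong (upTo k) (λ y → ∑-map (y ∷ᵥ_) (allVecs n k) _) ⟩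
  ∑[ y ← upTo k ] ∑[ σ ← allVecs n k ] f (y ∷ toList σ)             ≡⟨ ∑-cong (upTo k) (λ y → ∑-allVecs n k (f ∘ (y ∷_))) ⟩
  ∑[ y ← upTo k ] ∑[ w ← words n k ] f (y ∷ w)                      ≡⟨ ∑-words-suc n k f ⟨
  ∑ (words (suc n) k) f                                              ∎
  where open ≡-Reasoning

∑-words-++ : ∀ a c k (f : List ℕ → ℕ) → ∑ (words (a + c) k) f ≡ ∑[ u ← words a k ] ∑[ v ← words c k ] f (u ++ v)
∑-words-++ zero    c k f = sym (+-identityʳ _)
∑-words-++ (suc a) c k f = begin
  ∑ (words (suc a + c) k) f                                                    ≡⟨ ∑-words-suc (a + c) k f ⟩
  ∑[ y ← upTo k ] ∑[ w ← words (a + c) k ] f (y ∷ w)                           ≡⟨ ∑-cong (upTo k) (λ y → ∑-words-++ a c k (f ∘ (y ∷_))) ⟩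
  ∑[ y ← upTo k ] ∑[ u ← words a k ] ∑[ v ← words c k ] f (y ∷ u ++ v)         ≡⟨ ∑-words-suc a k _ ⟨
  ∑[ u ← words (suc a) k ] ∑[ v ← words c k ] f (u ++ v)                       ∎
  where open ≡-Reasoning

module _ (n k : ℕ) where

  ∑-words-cong : {f g : List ℕ → ℕ} → (∀ w → length w ≡ n → All (_< k) w → f w ≡ g w) →
                 ∑ (words n k) f ≡ ∑ (words n k) g
  ∑-words-cong f≗g = ∑-cong-∈ (words n k) (λ w w∈ → let ∣w∣≡n , w<k = ∈-words⁻ n k w∈ in f≗g w ∣w∣≡n w<k)

  ∑-words-zero : {f : List ℕ → ℕ} → (∀ w → length w ≡ n → All (_< k) w → f w ≡ 0) → ∑ (words n k) f ≡ 0
  ∑-words-zero f≗0 = ∑-zero-∈ (words n k) (λ w w∈ → let ∣w∣≡n , w<k = ∈-words⁻ n k w∈ in f≗0 w ∣w∣≡n w<k)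

∑-words-widen : ∀ n k k′ (f : List ℕ → ℕ) → k ≤ k′ → (∀ w → length w ≡ n → ¬ All (_< k) w → f w ≡ 0) →
                ∑ (words n k′) f ≡ ∑ (words n k) f
∑-words-widen n k k′ f k≤k′ f≡0 = begin
  ∑ (words n k′) f            ≡⟨ cong (λ k″ → ∑ (words n k″) f) (m+[n∸m]≡n k≤k′) ⟨
  ∑ (words n (k + e)) f       ≡⟨ widen n f f≡0 ⟩
  ∑ (words n k) f             ∎
  where
  open ≡-Reasoning
  e = k′ ∸ k
  widen : ∀ n (f : List ℕ → ℕ) → (∀ w → length w ≡ n → ¬ All (_< k) w → f w ≡ 0) →
          ∑ (words n (k + e)) f ≡ ∑ (words n k) f
  widen zero    f f≡0 = refl
  widen (suc n) f f≡0 = begin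
    ∑ (words (suc n) (k + e)) f                                  ≡⟨ ∑-words-suc n (k + e) f ⟩
    ∑[ y ← upTo (k + e) ] ∑[ w ← words n (k + e) ] f (y ∷ w)      ≡⟨ ∑-upTo-+ k e _ ⟩
    (∑[ y ← upTo k ] ∑[ w ← words n (k + e) ] f (y ∷ w))
      + (∑[ i ← upTo e ] ∑[ w ← words n (k + e) ] f (k + i ∷ w))  ≡⟨ cong₂ _+_ small large ⟩
    (∑[ y ← upTo k ] ∑[ w ← words n k ] f (y ∷ w)) + 0           ≡⟨ +-identityʳ _ ⟩
    ∑[ y ← upTo k ] ∑[ w ← words n k ] f (y ∷ w)                 ≡⟨ ∑-words-suc n k f ⟨
    ∑ (words (suc n) k) f                                        ∎
    where
    small : ∑[ y ← upTo k ] ∑[ w ← words n (k + e) ] f (y ∷ w) ≡ ∑[ y ← upTo k ] ∑[ w ← words n k ] f (y ∷ w)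
    small = ∑-cong-∈ (upTo k) (λ y y∈ → widen n (f ∘ (y ∷_))
                     (λ w ∣w∣≡n ¬w<k → f≡0 (y ∷ w) (cong suc ∣w∣≡n) (λ { (_ ∷ w<k) → ¬w<k w<k })))
    large : ∑[ i ← upTo e ] ∑[ w ← words n (k + e) ] f (k + i ∷ w) ≡ 0
    large = ∑-zero (upTo e) (λ i → ∑-words-zero n (k + e)
                   (λ w ∣w∣≡n _ → f≡0 (k + i ∷ w) (cong suc ∣w∣≡n) (λ { (k+i<k ∷ _) → m+n≮m k i k+i<k })))

∑-words-constant : ∀ n k m → m < k → ∑[ w ← words n k ] 𝟙 (all? (_≟ m) w) ≡ 1
∑-words-constant zero    k m m<k = refl
∑-words-constant (suc n) k m m<k = begin
  ∑[ w ← words (suc n) k ] 𝟙 (all? (_≟ m) w)                          ≡⟨ ∑-words-suc n k _ ⟩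
  ∑[ y ← upTo k ] ∑[ w ← words n k ] 𝟙 (all? (_≟ m) (y ∷ w))           ≡⟨ ∑-cong (upTo k) head ⟩
  ∑[ y ← upTo k ] (𝟙 (y ≟ m) * (∑[ w ← words n k ] 𝟙 (all? (_≟ m) w)))   ≡⟨ ∑-δ k m _ m<k ⟩
  ∑[ w ← words n k ] 𝟙 (all? (_≟ m) w)                                ≡⟨ ∑-words-constant n k m m<k ⟩
  1                                                                    ∎
  where
  open ≡-Reasoning
  all-∷ : ∀ y w → 𝟙 (all? (_≟ m) (y ∷ w)) ≡ 𝟙 (y ≟ m) * 𝟙 (all? (_≟ m) w)
  all-∷ y w = trans (𝟙-cong (mk⇔ All.uncons (λ (p , q) → p ∷ q)) (all? (_≟ m) (y ∷ w)) ((y ≟ m) ×-dec all? (_≟ m) w))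
                    (𝟙-× (y ≟ m) (all? (_≟ m) w))
  head : ∀ y → ∑[ w ← words n k ] 𝟙 (all? (_≟ m) (y ∷ w)) ≡ 𝟙 (y ≟ m) * (∑[ w ← words n k ] 𝟙 (all? (_≟ m) w))
  head y = trans (∑-cong (words n k) (all-∷ y)) (∑-*ˡ (words n k) (𝟙 (y ≟ m)) _)

∈-∷-≢ : ∀ {x y : ℕ} {w} → x ≢ y → x ∈ y ∷ w ⇔ x ∈ w
∈-∷-≢ x≢y = mk⇔ (λ { (here x≡y) → ⊥-elim (x≢y x≡y) ; (there x∈w) → x∈w }) there

𝟙-∈-∷ : ∀ x y w → 𝟙 (x ∈? (y ∷ w)) ≡ 𝟙 (y ≟ x) + 𝟙 (¬? (y ≟ x)) * 𝟙 (x ∈? w)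
𝟙-∈-∷ x y w with y ≟ x
... | yes refl = 𝟙-yes (x ∈? (x ∷ w)) (here refl)
... | no y≢x   = trans (𝟙-cong (∈-∷-≢ (y≢x ∘ sym)) (x ∈? (y ∷ w)) (x ∈? w)) (sym (+-identityʳ _))

𝟙-∉-∷ : ∀ x y w → 𝟙 (¬? (x ∈? (y ∷ w))) ≡ 𝟙 (¬? (y ≟ x)) * 𝟙 (¬? (x ∈? w))
𝟙-∉-∷ x y w with y ≟ x
... | yes refl = 𝟙-no (¬? (x ∈? (x ∷ w))) (λ x∉ → x∉ (here refl))
... | no y≢x   = trans (𝟙-cong (mk⇔ (λ x∉ → x∉ ∘ Equivalence.from x∈⇔) (λ x∉ → x∉ ∘ Equivalence.to x∈⇔)) (¬? (x ∈? (y ∷ w))) (¬? (x ∈? w)))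
                       (sym (+-identityʳ _))
  where x∈⇔ = ∈-∷-≢ {w = w} (y≢x ∘ sym)

∑-words-firstOccurrence : ∀ {k x} → x < k → ∀ L (F : List ℕ → ℕ) →
  ∑[ w ← words L k ] (𝟙 (x ∈? w) * F w)
  ≡ ∑[ a ← upTo L ] ∑[ α ← words a k ] (𝟙 (¬? (x ∈? α)) * (∑[ γ ← words (L ∸ suc a) k ] F (α ++ x ∷ γ)))
∑-words-firstOccurrence x<k zero    F = refl
∑-words-firstOccurrence {k} {x} x<k (suc L) F = begin
  ∑[ w ← words (suc L) k ] (𝟙 (x ∈? w) * F w)
    ≡⟨ ∑-words-suc L k _ ⟩
  ∑[ y ← upTo k ] ∑[ w ← words L k ] (𝟙 (x ∈? (y ∷ w)) * F (y ∷ w))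
    ≡⟨ ∑-cong (upTo k) splitHead ⟩
  ∑[ y ← upTo k ] (𝟙 (y ≟ x) * (∑[ w ← words L k ] F (y ∷ w))
                   + 𝟙 (¬? (y ≟ x)) * (∑[ w ← words L k ] (𝟙 (x ∈? w) * F (y ∷ w))))
    ≡⟨ ∑-distrib-+ (upTo k) _ _ ⟩
  (∑[ y ← upTo k ] (𝟙 (y ≟ x) * (∑[ w ← words L k ] F (y ∷ w))))
    + (∑[ y ← upTo k ] (𝟙 (¬? (y ≟ x)) * (∑[ w ← words L k ] (𝟙 (x ∈? w) * F (y ∷ w)))))
    ≡⟨ cong₂ _+_ (∑-δ k x _ x<k) laterOccurrence ⟩
  (∑[ γ ← words L k ] F (x ∷ γ)) + (∑[ a ← upTo L ] ∑[ α ← words (suc a) k ] (𝟙 (¬? (x ∈? α)) * T a α))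
    ≡⟨ cong (_+ (∑[ a ← upTo L ] ∑[ α ← words (suc a) k ] (𝟙 (¬? (x ∈? α)) * T a α))) (trans (+-identityʳ _) (+-identityʳ _)) ⟨
  (∑[ α ← words 0 k ] (𝟙 (¬? (x ∈? α)) * (∑[ γ ← words L k ] F (α ++ x ∷ γ))))
    + (∑[ a ← upTo L ] ∑[ α ← words (suc a) k ] (𝟙 (¬? (x ∈? α)) * T a α))
    ≡⟨ ∑-upTo-suc L _ ⟨
  ∑[ a ← upTo (suc L) ] ∑[ α ← words a k ] (𝟙 (¬? (x ∈? α)) * (∑[ γ ← words (suc L ∸ suc a) k ] F (α ++ x ∷ γ)))
    ∎
  where
  open ≡-Reasoning
  T : ℕ → List ℕ → ℕ
  T a α = ∑[ γ ← words (L ∸ suc a) k ] F (α ++ x ∷ γ)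
  T′ : ℕ → ℕ → List ℕ → ℕ
  T′ a y α = 𝟙 (¬? (x ∈? α)) * T a (y ∷ α)

  splitHead : ∀ y → ∑[ w ← words L k ] (𝟙 (x ∈? (y ∷ w)) * F (y ∷ w))
                    ≡ 𝟙 (y ≟ x) * (∑[ w ← words L k ] F (y ∷ w))
                      + 𝟙 (¬? (y ≟ x)) * (∑[ w ← words L k ] (𝟙 (x ∈? w) * F (y ∷ w)))
  splitHead y = begin
    ∑[ w ← words L k ] (𝟙 (x ∈? (y ∷ w)) * F (y ∷ w))
      ≡⟨ ∑-cong (words L k) (λ w → cong (_* F (y ∷ w)) (𝟙-∈-∷ x y w)) ⟩
    ∑[ w ← words L k ] ((𝟙 (y ≟ x) + 𝟙 (¬? (y ≟ x)) * 𝟙 (x ∈? w)) * F (y ∷ w))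
      ≡⟨ ∑-cong (words L k) (λ w → trans (*-distribʳ-+ (F (y ∷ w)) (𝟙 (y ≟ x)) _)
                                         (cong (𝟙 (y ≟ x) * F (y ∷ w) +_) (*-assoc (𝟙 (¬? (y ≟ x))) (𝟙 (x ∈? w)) (F (y ∷ w))))) ⟩
    ∑[ w ← words L k ] (𝟙 (y ≟ x) * F (y ∷ w) + 𝟙 (¬? (y ≟ x)) * (𝟙 (x ∈? w) * F (y ∷ w)))
      ≡⟨ ∑-distrib-+ (words L k) _ _ ⟩
    (∑[ w ← words L k ] (𝟙 (y ≟ x) * F (y ∷ w))) + (∑[ w ← words L k ] (𝟙 (¬? (y ≟ x)) * (𝟙 (x ∈? w) * F (y ∷ w))))
      ≡⟨ cong₂ _+_ (∑-*ˡ (words L k) (𝟙 (y ≟ x)) (F ∘ (y ∷_)))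
                   (∑-*ˡ (words L k) (𝟙 (¬? (y ≟ x))) (λ w → 𝟙 (x ∈? w) * F (y ∷ w))) ⟩
    𝟙 (y ≟ x) * (∑[ w ← words L k ] F (y ∷ w)) + 𝟙 (¬? (y ≟ x)) * (∑[ w ← words L k ] (𝟙 (x ∈? w) * F (y ∷ w)))
      ∎

  laterOccurrence : ∑[ y ← upTo k ] (𝟙 (¬? (y ≟ x)) * (∑[ w ← words L k ] (𝟙 (x ∈? w) * F (y ∷ w))))
                    ≡ ∑[ a ← upTo L ] ∑[ α ← words (suc a) k ] (𝟙 (¬? (x ∈? α)) * T a α)
  laterOccurrence = begin
    ∑[ y ← upTo k ] (𝟙 (¬? (y ≟ x)) * (∑[ w ← words L k ] (𝟙 (x ∈? w) * F (y ∷ w))))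
      ≡⟨ ∑-cong (upTo k) (λ y → cong (𝟙 (¬? (y ≟ x)) *_) (∑-words-firstOccurrence x<k L (F ∘ (y ∷_)))) ⟩
    ∑[ y ← upTo k ] (𝟙 (¬? (y ≟ x)) * (∑[ a ← upTo L ] ∑[ α ← words a k ] (𝟙 (¬? (x ∈? α)) * T a (y ∷ α))))
      ≡⟨ ∑-cong (upTo k) (λ y → sym (trans (∑-cong (upTo L) (λ a → ∑-*ˡ (words a k) (𝟙 (¬? (y ≟ x))) (λ α → T′ a y α)))
                                              (∑-*ˡ (upTo L) (𝟙 (¬? (y ≟ x))) (λ a → ∑[ α ← words a k ] T′ a y α)))) ⟩
    ∑[ y ← upTo k ] ∑[ a ← upTo L ] ∑[ α ← words a k ] (𝟙 (¬? (y ≟ x)) * (𝟙 (¬? (x ∈? α)) * T a (y ∷ α)))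
      ≡⟨ ∑-comm (upTo k) (upTo L) _ ⟩
    ∑[ a ← upTo L ] ∑[ y ← upTo k ] ∑[ α ← words a k ] (𝟙 (¬? (y ≟ x)) * (𝟙 (¬? (x ∈? α)) * T a (y ∷ α)))
      ≡⟨ ∑-cong (upTo L) (λ a → ∑-cong (upTo k) (λ y → ∑-cong (words a k) (λ α →
           trans (sym (*-assoc (𝟙 (¬? (y ≟ x))) _ _)) (cong (_* T a (y ∷ α)) (sym (𝟙-∉-∷ x y α)))))) ⟩
    ∑[ a ← upTo L ] ∑[ y ← upTo k ] ∑[ α ← words a k ] (𝟙 (¬? (x ∈? (y ∷ α))) * T a (y ∷ α))
      ≡⟨ ∑-cong (upTo L) (λ a → ∑-words-suc a k _) ⟨
    ∑[ a ← upTo L ] ∑[ α ← words (suc a) k ] (𝟙 (¬? (x ∈? α)) * T a α)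
      ∎

-- Sublists and 010-avoidance

ListAvoids010 : List ℕ → Set
ListAvoids010 v = ∀ a b → a < b → ¬ (a ∷ b ∷ a ∷ [] ⊆ v)

listAvoids010? : ∀ v → Dec (ListAvoids010 v)
listAvoids010? v with any? (λ a → any? (λ b → (a <? b) ×-dec (a ∷ b ∷ a ∷ [] ⊆? v)) v) v
... | yes occurrence with Any.satisfied occurrence
...   | a , occurrence′ with Any.satisfied occurrence′
...     | b , a<b , aba⊆v = no (λ avoids → avoids a b a<b aba⊆v)
listAvoids010? v | no noOccurrence =
  yes (λ a b a<b aba⊆v → noOccurrence (lose (to∈ aba⊆v) (lose (to∈ (∷ˡ⁻ aba⊆v)) (a<b , aba⊆v))))

listAvoids010-⊆ : ∀ {xs ys} → xs ⊆ ys → ListAvoids010 ys → ListAvoids010 xs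
listAvoids010-⊆ xs⊆ys avoids a b a<b aba⊆xs = avoids a b a<b (⊆-trans aba⊆xs xs⊆ys)

⊆-delete : ∀ p {x q xs} → xs ⊆ p ++ x ∷ q → All (_≢ x) xs → xs ⊆ p ++ q
⊆-delete []      (_ ∷ʳ xs⊆q)    _            = xs⊆q
⊆-delete []      (refl ∷ _)     (x≢x ∷ _)    = ⊥-elim (x≢x refl)
⊆-delete (y ∷ p) (_ ∷ʳ xs⊆)     xs≢x         = y ∷ʳ ⊆-delete p xs⊆ xs≢x
⊆-delete (y ∷ p) (refl ∷ xs⊆)   (_ ∷ xs≢x)   = refl ∷ ⊆-delete p xs⊆ xs≢x

⊆-skipPrefix : ∀ p {x xs q} → x ∷ xs ⊆ p ++ q → x ∉ p → x ∷ xs ⊆ q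
⊆-skipPrefix []      x∷xs⊆q      _   = x∷xs⊆q
⊆-skipPrefix (y ∷ p) (refl ∷ _)  x∉p = ⊥-elim (x∉p (here refl))
⊆-skipPrefix (y ∷ p) (_ ∷ʳ x∷xs⊆) x∉p = ⊆-skipPrefix p x∷xs⊆ (x∉p ∘ there)

second-occurrence : ∀ p {x q} → x ∷ x ∷ [] ⊆ p ++ x ∷ q → x ∉ p → x ∈ q
second-occurrence p xx⊆ x∉p with ⊆-skipPrefix p xx⊆ x∉p
... | refl ∷ x⊆q = to∈ x⊆q
... | _ ∷ʳ xx⊆q  = to∈ (∷ˡ⁻ xx⊆q)

⊆-++⁻ : ∀ u {w xs} → xs ⊆ u ++ w → ∃₂ λ xs₁ xs₂ → xs ≡ xs₁ ++ xs₂ × xs₁ ⊆ u × xs₂ ⊆ w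
⊆-++⁻ []      xs⊆w         = [] , _ , refl , [] , xs⊆w
⊆-++⁻ (y ∷ u) (y ∷ʳ xs⊆)   with ⊆-++⁻ u xs⊆
... | xs₁ , xs₂ , refl , xs₁⊆u , xs₂⊆w = xs₁ , xs₂ , refl , y ∷ʳ xs₁⊆u , xs₂⊆w
⊆-++⁻ (y ∷ u) (refl ∷ xs⊆) with ⊆-++⁻ u xs⊆
... | xs₁ , xs₂ , refl , xs₁⊆u , xs₂⊆w = y ∷ xs₁ , xs₂ , refl , refl ∷ xs₁⊆u , xs₂⊆w

010-⊆-++⁻ : ∀ u {w a b} → a ∷ b ∷ a ∷ [] ⊆ u ++ w →
            a ∷ b ∷ a ∷ [] ⊆ u ⊎ (a ∈ u × a ∈ w) ⊎ a ∷ b ∷ a ∷ [] ⊆ w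
010-⊆-++⁻ u aba⊆ with ⊆-++⁻ u aba⊆
... | []                  , _ , refl , _     , aba⊆w = inj₂ (inj₂ aba⊆w)
... | _ ∷ []              , _ , refl , a⊆u   , ba⊆w  = inj₂ (inj₁ (to∈ a⊆u , to∈ (∷ˡ⁻ ba⊆w)))
... | _ ∷ _ ∷ []          , _ , refl , ab⊆u  , a⊆w   = inj₂ (inj₁ (to∈ ab⊆u , to∈ a⊆w))
... | _ ∷ _ ∷ _ ∷ []      , _ , refl , aba⊆u , _     = inj₁ aba⊆u
... | _ ∷ _ ∷ _ ∷ _ ∷ _   , _ , () , _ , _

module _ {P : ℕ → Set} where

  All-insert⁻ : ∀ p {x q} → All P (p ++ x ∷ q) → All P (p ++ q) × P x
  All-insert⁻ p P[p++x∷q] with All.++⁻ p P[p++x∷q]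
  ... | P[p] , P[x] ∷ P[q] = All.++⁺ P[p] P[q] , P[x]

  All-insert⁺ : ∀ p {x q} → All P (p ++ q) → P x → All P (p ++ x ∷ q)
  All-insert⁺ p P[p++q] P[x] = let P[p] , P[q] = All.++⁻ p P[p++q] in All.++⁺ P[p] (P[x] ∷ P[q])

∈-insert : ∀ (p : List ℕ) {x q y} → y ∈ p ++ q → y ∈ p ++ x ∷ q
∈-insert p {x} {q} y∈ = [ ∈-++⁺ˡ , (λ y∈q → ∈-++⁺ʳ p (there y∈q)) ]′ (∈-++⁻ p y∈)

∈-delete : ∀ (p : List ℕ) {x q y} → y ≢ x → y ∈ p ++ x ∷ q → y ∈ p ++ q
∈-delete []      y≢x (here y≡x)  = ⊥-elim (y≢x y≡x)
∈-delete []      y≢x (there y∈q) = y∈q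
∈-delete (z ∷ p) y≢x (here y≡z)  = here y≡z
∈-delete (z ∷ p) y≢x (there y∈)  = there (∈-delete p y≢x y∈)

-- Distinct values, maximum, inversion condition

distinct : List ℕ → ℕ
distinct []       = 0
distinct (y ∷ ys) = 𝟙 (¬? (y ∈? ys)) + distinct ys

1≤distinct-∷ : ∀ y ys → 1 ≤ distinct (y ∷ ys)
1≤distinct-∷ y []       = s≤s z≤n
1≤distinct-∷ y (z ∷ zs) with y ∈? (z ∷ zs)
... | yes _ = 1≤distinct-∷ z zs
... | no _  = s≤s z≤n

distinct≤length : ∀ v → distinct v ≤ length v
distinct≤length []       = z≤n
distinct≤length (y ∷ ys) = +-mono-≤ (𝟙≤1 (¬? (y ∈? ys))) (distinct≤length ys)

distinct-insert : ∀ p x q → distinct (p ++ x ∷ q) ≡ distinct (p ++ q) + 𝟙 (¬? (x ∈? (p ++ q)))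
distinct-insert []      x q = +-comm (𝟙 (¬? (x ∈? q))) (distinct q)
distinct-insert (y ∷ p) x q with y ≟ x
... | yes refl = begin
  𝟙 (¬? (y ∈? (p ++ y ∷ q))) + distinct (p ++ y ∷ q)
    ≡⟨ cong₂ _+_ (𝟙-no (¬? (y ∈? (p ++ y ∷ q))) (λ y∉ → y∉ (∈-++⁺ʳ p (here refl)))) (distinct-insert p y q) ⟩
  distinct (p ++ q) + 𝟙 (¬? (y ∈? (p ++ q)))
    ≡⟨ +-comm (distinct (p ++ q)) _ ⟩
  𝟙 (¬? (y ∈? (p ++ q))) + distinct (p ++ q)
    ≡⟨ +-identityʳ _ ⟨
  𝟙 (¬? (y ∈? (p ++ q))) + distinct (p ++ q) + 0
    ≡⟨ cong (𝟙 (¬? (y ∈? (p ++ q))) + distinct (p ++ q) +_) (𝟙-no (¬? (y ∈? (y ∷ p ++ q))) (λ y∉ → y∉ (here refl))) ⟨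
  𝟙 (¬? (y ∈? (p ++ q))) + distinct (p ++ q) + 𝟙 (¬? (y ∈? (y ∷ p ++ q)))
    ∎
  where open ≡-Reasoning
... | no y≢x = begin
  𝟙 (¬? (y ∈? (p ++ x ∷ q))) + distinct (p ++ x ∷ q)
    ≡⟨ cong₂ _+_ yUnaffected (distinct-insert p x q) ⟩
  𝟙 (¬? (y ∈? (p ++ q))) + (distinct (p ++ q) + 𝟙 (¬? (x ∈? (p ++ q))))
    ≡⟨ +-assoc (𝟙 (¬? (y ∈? (p ++ q)))) _ _ ⟨
  𝟙 (¬? (y ∈? (p ++ q))) + distinct (p ++ q) + 𝟙 (¬? (x ∈? (p ++ q)))
    ≡⟨ cong (𝟙 (¬? (y ∈? (p ++ q))) + distinct (p ++ q) +_) xUnaffected ⟩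
  𝟙 (¬? (y ∈? (p ++ q))) + distinct (p ++ q) + 𝟙 (¬? (x ∈? (y ∷ p ++ q)))
    ∎
  where
  open ≡-Reasoning
  yUnaffected : 𝟙 (¬? (y ∈? (p ++ x ∷ q))) ≡ 𝟙 (¬? (y ∈? (p ++ q)))
  yUnaffected = 𝟙-cong (mk⇔ (λ y∉ y∈ → y∉ (∈-insert p y∈)) (λ y∉ y∈ → y∉ (∈-delete p y≢x y∈)))
                       (¬? (y ∈? (p ++ x ∷ q))) (¬? (y ∈? (p ++ q)))
  xUnaffected : 𝟙 (¬? (x ∈? (p ++ q))) ≡ 𝟙 (¬? (x ∈? (y ∷ p ++ q)))
  xUnaffected = 𝟙-cong (mk⇔ (λ { x∉ (here x≡y) → y≢x (sym x≡y) ; x∉ (there x∈) → x∉ x∈ }) (λ x∉ → x∉ ∘ there))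
                       (¬? (x ∈? (p ++ q))) (¬? (x ∈? (y ∷ p ++ q)))

distinct-++ : ∀ u w → (∀ {y} → y ∈ u → y ∉ w) → distinct (u ++ w) ≡ distinct u + distinct w
distinct-++ []      w _        = refl
distinct-++ (y ∷ u) w disjoint = begin
  𝟙 (¬? (y ∈? (u ++ w))) + distinct (u ++ w)  ≡⟨ cong₂ _+_ headUnaffected (distinct-++ u w (disjoint ∘ there)) ⟩
  𝟙 (¬? (y ∈? u)) + (distinct u + distinct w) ≡⟨ +-assoc (𝟙 (¬? (y ∈? u))) _ _ ⟨
  𝟙 (¬? (y ∈? u)) + distinct u + distinct w   ∎
  where
  open ≡-Reasoning
  headUnaffected : 𝟙 (¬? (y ∈? (u ++ w))) ≡ 𝟙 (¬? (y ∈? u))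
  headUnaffected = 𝟙-cong (mk⇔ (λ y∉ y∈u → y∉ (∈-++⁺ˡ y∈u)) (λ y∉ y∈ → [ y∉ , disjoint (here refl) ]′ (∈-++⁻ u {w} y∈)))
                          (¬? (y ∈? (u ++ w))) (¬? (y ∈? u))

length-deduplicate : ∀ xs → length (deduplicate _≟_ xs) ≡ distinct xs
length-deduplicate []       = refl
length-deduplicate (x ∷ xs) = +-cancelʳ-≡ (𝟙 (x ∈? xs)) _ _ (begin
  suc (length (filter (¬? ∘ (x ≟_)) D)) + 𝟙 (x ∈? xs)  ≡⟨ cong (λ i → suc (length (filter (¬? ∘ (x ≟_)) D) + i)) x∈D⇔x∈xs ⟨
  suc (length (filter (¬? ∘ (x ≟_)) D) + 𝟙 (x ∈? D))   ≡⟨ cong suc (length-filter-≢ x D (deduplicate-! xs)) ⟩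
  suc (length D)                                       ≡⟨ cong suc (length-deduplicate xs) ⟩
  suc (distinct xs)                                    ≡⟨ cong (_+ distinct xs) (𝟙-¬ (x ∈? xs)) ⟨
  𝟙 (¬? (x ∈? xs)) + 𝟙 (x ∈? xs) + distinct xs        ≡⟨ +-assoc (𝟙 (¬? (x ∈? xs))) _ _ ⟩
  𝟙 (¬? (x ∈? xs)) + (𝟙 (x ∈? xs) + distinct xs)      ≡⟨ cong (𝟙 (¬? (x ∈? xs)) +_) (+-comm (𝟙 (x ∈? xs)) _) ⟩
  𝟙 (¬? (x ∈? xs)) + (distinct xs + 𝟙 (x ∈? xs))      ≡⟨ +-assoc (𝟙 (¬? (x ∈? xs))) _ _ ⟨
  distinct (x ∷ xs) + 𝟙 (x ∈? xs)                     ∎)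
  where
  open ≡-Reasoning
  D = deduplicate _≟_ xs
  x∈D⇔x∈xs : 𝟙 (x ∈? D) ≡ 𝟙 (x ∈? xs)
  x∈D⇔x∈xs = 𝟙-cong (mk⇔ (∈-deduplicate⁻ _≟_ xs) (∈-deduplicate⁺ _≟_)) (x ∈? D) (x ∈? xs)
  length-filter-≢ : ∀ x zs → Unique zs → length (filter (¬? ∘ (x ≟_)) zs) + 𝟙 (x ∈? zs) ≡ length zs
  length-filter-≢ x []       _             = refl
  length-filter-≢ x (z ∷ zs) (z∉zs ∷ uniq) = byHead (x ≟ z) z∉zs
    where
    P? = ¬? ∘ (x ≟_)
    byHead : Dec (x ≡ z) → All (z ≢_) zs → length (filter P? (z ∷ zs)) + 𝟙 (x ∈? (z ∷ zs)) ≡ suc (length zs)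
    byHead (yes refl) x∉zs = begin
      length (filter P? (x ∷ zs)) + 𝟙 (x ∈? (x ∷ zs))
        ≡⟨ cong₂ (λ l i → length l + i) (filter-reject P? (λ x≢x → x≢x refl)) (𝟙-yes (x ∈? (x ∷ zs)) (here refl)) ⟩
      length (filter P? zs) + 1
        ≡⟨ cong (λ l → length l + 1) (filter-all zs x∉zs) ⟩
      length zs + 1
        ≡⟨ +-comm (length zs) 1 ⟩
      suc (length zs)
        ∎
      where
      filter-all : ∀ ws → All (x ≢_) ws → filter P? ws ≡ ws
      filter-all []       _            = refl
      filter-all (w ∷ ws) (x≢w ∷ x≢ws) = trans (filter-accept P? x≢w) (cong (w ∷_) (filter-all ws x≢ws))
    byHead (no x≢z) _ = begin
      length (filter P? (z ∷ zs)) + 𝟙 (x ∈? (z ∷ zs))  ≡⟨ cong₂ (λ l i → length l + i) (filter-accept P? x≢z) x∈z∷zs⇔x∈zs ⟩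
      suc (length (filter P? zs) + 𝟙 (x ∈? zs))        ≡⟨ cong suc (length-filter-≢ x zs uniq) ⟩
      suc (length zs)                                  ∎
      where
      x∈z∷zs⇔x∈zs : 𝟙 (x ∈? (z ∷ zs)) ≡ 𝟙 (x ∈? zs)
      x∈z∷zs⇔x∈zs = 𝟙-cong (∈-∷-≢ x≢z) (x ∈? (z ∷ zs)) (x ∈? zs)

∑-∈≡distinct : ∀ M u → All (_< M) u → ∑[ j ← upTo M ] 𝟙 (j ∈? u) ≡ distinct u
∑-∈≡distinct M []      _          = ∑-zero (upTo M) (λ _ → refl)
∑-∈≡distinct M (y ∷ u) (y<M ∷ u<M) = begin
  ∑[ j ← upTo M ] 𝟙 (j ∈? (y ∷ u))                                              ≡⟨ ∑-cong (upTo M) (λ j → 𝟙-∈-∷′ j (j ≟ y)) ⟩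
  ∑[ j ← upTo M ] (𝟙 (j ∈? u) + 𝟙 (j ≟ y) * 𝟙 (¬? (y ∈? u)))                   ≡⟨ ∑-distrib-+ (upTo M) _ _ ⟩
  (∑[ j ← upTo M ] 𝟙 (j ∈? u)) + (∑[ j ← upTo M ] (𝟙 (j ≟ y) * 𝟙 (¬? (y ∈? u)))) ≡⟨ cong₂ _+_ (∑-∈≡distinct M u u<M) (∑-δ M y _ y<M) ⟩
  distinct u + 𝟙 (¬? (y ∈? u))                                                   ≡⟨ +-comm (distinct u) _ ⟩
  distinct (y ∷ u)                                                               ∎
  where
  open ≡-Reasoning
  𝟙-∈-∷′ : ∀ j → Dec (j ≡ y) → 𝟙 (j ∈? (y ∷ u)) ≡ 𝟙 (j ∈? u) + 𝟙 (j ≟ y) * 𝟙 (¬? (y ∈? u))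
  𝟙-∈-∷′ j (yes refl) = begin
    𝟙 (j ∈? (j ∷ u))                            ≡⟨ 𝟙-yes (j ∈? (j ∷ u)) (here refl) ⟩
    1                                           ≡⟨ 𝟙-¬ (j ∈? u) ⟨
    𝟙 (¬? (j ∈? u)) + 𝟙 (j ∈? u)                ≡⟨ +-comm (𝟙 (¬? (j ∈? u))) _ ⟩
    𝟙 (j ∈? u) + 𝟙 (¬? (j ∈? u))                ≡⟨ cong (𝟙 (j ∈? u) +_) (*-identityˡ _) ⟨
    𝟙 (j ∈? u) + 1 * 𝟙 (¬? (j ∈? u))            ≡⟨ cong (λ i → 𝟙 (j ∈? u) + i * 𝟙 (¬? (j ∈? u))) (𝟙-yes (j ≟ j) refl) ⟨
    𝟙 (j ∈? u) + 𝟙 (j ≟ j) * 𝟙 (¬? (j ∈? u))    ∎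
  𝟙-∈-∷′ j (no j≢y) = begin
    𝟙 (j ∈? (y ∷ u))
      ≡⟨ 𝟙-cong (∈-∷-≢ j≢y) (j ∈? (y ∷ u)) (j ∈? u) ⟩
    𝟙 (j ∈? u)
      ≡⟨ +-identityʳ _ ⟨
    𝟙 (j ∈? u) + 0
      ≡⟨ cong (λ i → 𝟙 (j ∈? u) + i * 𝟙 (¬? (y ∈? u))) (𝟙-no (j ≟ y) j≢y) ⟨
    𝟙 (j ∈? u) + 𝟙 (j ≟ y) * 𝟙 (¬? (y ∈? u))
      ∎

∑-∉≡∸distinct : ∀ M u → All (_< M) u → ∑[ j ← upTo M ] 𝟙 (¬? (j ∈? u)) ≡ M ∸ distinct u
∑-∉≡∸distinct M u u<M = begin
  N
    ≡⟨ m+n∸n≡m N (distinct u) ⟨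
  N + distinct u ∸ distinct u
    ≡⟨ cong (λ i → N + i ∸ distinct u) (∑-∈≡distinct M u u<M) ⟨
  N + (∑[ j ← upTo M ] 𝟙 (j ∈? u)) ∸ distinct u
    ≡⟨ cong (_∸ distinct u) (∑-distrib-+ (upTo M) _ _) ⟨
  (∑[ j ← upTo M ] (𝟙 (¬? (j ∈? u)) + 𝟙 (j ∈? u))) ∸ distinct u
    ≡⟨ cong (_∸ distinct u) (∑-cong (upTo M) (λ j → 𝟙-¬ (j ∈? u))) ⟩
  (∑[ _ ← upTo M ] 1) ∸ distinct u
    ≡⟨ cong (_∸ distinct u) (trans (∑-const (upTo M) 1) (trans (*-identityʳ _) (length-upTo M))) ⟩
  M ∸ distinct u
    ∎
  where
  open ≡-Reasoning
  N = ∑[ j ← upTo M ] 𝟙 (¬? (j ∈? u))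

maximum : List ℕ → ℕ
maximum []       = 0
maximum (y ∷ ys) = y ⊔ maximum ys

≤-maximum : ∀ v → All (_≤ maximum v) v
≤-maximum []       = []
≤-maximum (y ∷ ys) = m≤m⊔n y (maximum ys) ∷ All.map (λ z≤ → ≤-trans z≤ (m≤n⊔m y (maximum ys))) (≤-maximum ys)

maximum-≤ : ∀ {m} v → All (_≤ m) v → maximum v ≤ m
maximum-≤ []       _            = z≤n
maximum-≤ (y ∷ ys) (y≤m ∷ ys≤m) = ⊔-lub y≤m (maximum-≤ ys ys≤m)

maximum-∈ : ∀ y ys → maximum (y ∷ ys) ∈ y ∷ ys
maximum-∈ y []       rewrite ⊔-identityʳ y = here refl
maximum-∈ y (z ∷ zs) with ⊔-sel y (maximum (z ∷ zs))
... | inj₁ max≡y = here max≡y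
... | inj₂ max≡m = there (subst (_∈ z ∷ zs) (sym max≡m) (maximum-∈ z zs))

maximum-< : ∀ {n} y ys → All (_< n) (y ∷ ys) → maximum (y ∷ ys) < n
maximum-< y ys v<n = All.lookup v<n (maximum-∈ y ys)

HasMaximum : ℕ → List ℕ → Set
HasMaximum m v = All (_≤ m) v × m ∈ v

hasMaximum? : ∀ m v → Dec (HasMaximum m v)
hasMaximum? m v = all? (_≤? m) v ×-dec (m ∈? v)

HasMaximum⇒≡maximum : ∀ {m v} → HasMaximum m v → maximum v ≡ m
HasMaximum⇒≡maximum {v = v} (v≤m , m∈v) = ≤-antisym (maximum-≤ v v≤m) (All.lookup (≤-maximum v) m∈v)

hasMaximum-maximum : ∀ y ys → HasMaximum (maximum (y ∷ ys)) (y ∷ ys)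
hasMaximum-maximum y ys = ≤-maximum (y ∷ ys) , maximum-∈ y ys

IsInvSeqFrom : ℕ → List ℕ → Set
IsInvSeqFrom k []       = ⊤
IsInvSeqFrom k (x ∷ xs) = x ≤ k × IsInvSeqFrom (suc k) xs

isInvSeqFrom? : ∀ k xs → Dec (IsInvSeqFrom k xs)
isInvSeqFrom? k []       = yes tt
isInvSeqFrom? k (x ∷ xs) = (x ≤? k) ×-dec isInvSeqFrom? (suc k) xs

IsInvSeqFrom⇒< : ∀ k v → IsInvSeqFrom k v → All (_< k + length v) v
IsInvSeqFrom⇒< k []       _             = []
IsInvSeqFrom⇒< k (y ∷ ys) (y≤k , inv) = subst (y <_) (sym (+-suc k (length ys))) (s≤s (≤-trans y≤k (m≤m+n k (length ys))))
                                         ∷ All.map (λ {z} → subst (z <_) (sym (+-suc k (length ys)))) (IsInvSeqFrom⇒< (suc k) ys inv)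

IsInvSeqFrom-++⁻ : ∀ k u w → IsInvSeqFrom k (u ++ w) → IsInvSeqFrom k u × IsInvSeqFrom (k + length u) w
IsInvSeqFrom-++⁻ k []      w inv = tt , subst (λ k′ → IsInvSeqFrom k′ w) (sym (+-identityʳ k)) inv
IsInvSeqFrom-++⁻ k (y ∷ u) w (y≤k , inv) =
  let invᵤ , inv_w = IsInvSeqFrom-++⁻ (suc k) u w inv
  in (y≤k , invᵤ) , subst (λ k′ → IsInvSeqFrom k′ w) (sym (+-suc k (length u))) inv_w

IsInvSeqFrom-++⁺ : ∀ k u w → IsInvSeqFrom k u → IsInvSeqFrom (k + length u) w → IsInvSeqFrom k (u ++ w)
IsInvSeqFrom-++⁺ k []      w _            inv_w = subst (λ k′ → IsInvSeqFrom k′ w) (+-identityʳ k) inv_w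
IsInvSeqFrom-++⁺ k (y ∷ u) w (y≤k , invᵤ) inv_w =
  y≤k , IsInvSeqFrom-++⁺ (suc k) u w invᵤ (subst (λ k′ → IsInvSeqFrom k′ w) (+-suc k (length u)) inv_w)

IsInvSeqFrom-≤ : ∀ k w → All (_≤ k) w → IsInvSeqFrom k w
IsInvSeqFrom-≤ k []      _            = tt
IsInvSeqFrom-≤ k (y ∷ w) (y≤k ∷ w≤k) = y≤k , IsInvSeqFrom-≤ (suc k) w (All.map m≤n⇒m≤1+n w≤k)

-- From vectors to lists; the first identity

module _ {n} (σ : Vec ℕ n) where

  ∈-toList⇒lookup : ∀ {x} → x ∈ toList σ → ∃ λ i → lookup σ i ≡ x
  ∈-toList⇒lookup x∈ = let x∈σ = ∈-toList⁻ x∈ in index x∈σ , sym (lookup-index x∈σ)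

  All-toList⁺ : ∀ {P : ℕ → Set} → (∀ i → P (lookup σ i)) → All P (toList σ)
  All-toList⁺ {P} P[σ] = All.tabulate (λ x∈ → let i , σᵢ≡x = ∈-toList⇒lookup x∈ in subst P σᵢ≡x (P[σ] i))

  All-toList⁻ : ∀ {P : ℕ → Set} → All P (toList σ) → ∀ i → P (lookup σ i)
  All-toList⁻ P[σ] i = All.lookup P[σ] (∈-toList⁺ (∈-lookup i σ))

IsInvSeqFrom-toList⁺ : ∀ {n} k (σ : Vec ℕ n) → (∀ i → lookup σ i < suc (k + toℕ i)) → IsInvSeqFrom k (toList σ)
IsInvSeqFrom-toList⁺ k []ᵥ       _      = _
IsInvSeqFrom-toList⁺ k (x ∷ᵥ σ) σ<    =
  ≤-pred (subst (λ k′ → x < suc k′) (+-identityʳ k) (σ< fzero)) ,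
  IsInvSeqFrom-toList⁺ (suc k) σ (λ i → subst (λ k′ → lookup σ i < suc k′) (+-suc k (toℕ i)) (σ< (fsuc i)))

IsInvSeqFrom-toList⁻ : ∀ {n} k (σ : Vec ℕ n) → IsInvSeqFrom k (toList σ) → ∀ i → lookup σ i < suc (k + toℕ i)
IsInvSeqFrom-toList⁻ k (x ∷ᵥ σ) (x≤k , _)   fzero    = s≤s (subst (x ≤_) (sym (+-identityʳ k)) x≤k)
IsInvSeqFrom-toList⁻ k (x ∷ᵥ σ) (_   , inv) (fsuc i) =
  subst (λ k′ → lookup σ i < suc k′) (sym (+-suc k (toℕ i))) (IsInvSeqFrom-toList⁻ (suc k) σ inv i)

lookup-pair-⊆ : ∀ {n} (σ : Vec ℕ n) i j → i Fin.< j → lookup σ i ∷ lookup σ j ∷ [] ⊆ toList σ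
lookup-pair-⊆ (x ∷ᵥ σ) fzero    (fsuc j) _         = refl ∷ from∈ (∈-toList⁺ (∈-lookup j σ))
lookup-pair-⊆ (x ∷ᵥ σ) (fsuc i) (fsuc j) (s≤s i<j) = x ∷ʳ lookup-pair-⊆ σ i j i<j

pair-⊆-lookup : ∀ {n} (σ : Vec ℕ n) {y z} → y ∷ z ∷ [] ⊆ toList σ →
                ∃ λ i → ∃ λ j → i Fin.< j × lookup σ i ≡ y × lookup σ j ≡ z
pair-⊆-lookup (x ∷ᵥ σ) (refl ∷ z⊆) with ∈-toList⇒lookup σ (to∈ z⊆)
... | j , σⱼ≡z = fzero , fsuc j , s≤s z≤n , refl , σⱼ≡z
pair-⊆-lookup (x ∷ᵥ σ) (_ ∷ʳ yz⊆)  with pair-⊆-lookup σ yz⊆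
... | i , j , i<j , σᵢ≡y , σⱼ≡z = fsuc i , fsuc j , s≤s i<j , σᵢ≡y , σⱼ≡z

Contains010⇒⊆ : ∀ {n} (σ : Vec ℕ n) → Contains010 σ → ∃ λ a → ∃ λ b → a < b × a ∷ b ∷ a ∷ [] ⊆ toList σ
Contains010⇒⊆ (x ∷ᵥ σ) (fzero  , fsuc j , fsuc k , _ , s≤s j<k , x≡σₖ , x<σⱼ) =
  x , lookup σ j , x<σⱼ , refl ∷ subst (λ z → lookup σ j ∷ z ∷ [] ⊆ toList σ) (sym x≡σₖ) (lookup-pair-⊆ σ j k j<k)
Contains010⇒⊆ (x ∷ᵥ σ) (fsuc i , fsuc j , fsuc k , s≤s i<j , s≤s j<k , σᵢ≡σₖ , σᵢ<σⱼ)
  with Contains010⇒⊆ σ (i , j , k , i<j , j<k , σᵢ≡σₖ , σᵢ<σⱼ)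
... | a , b , a<b , aba⊆ = a , b , a<b , x ∷ʳ aba⊆

⊆⇒Contains010 : ∀ {n} (σ : Vec ℕ n) {a b} → a < b → a ∷ b ∷ a ∷ [] ⊆ toList σ → Contains010 σ
⊆⇒Contains010 (x ∷ᵥ σ) a<b (refl ∷ ba⊆) with pair-⊆-lookup σ ba⊆
... | j , k , j<k , σⱼ≡b , σₖ≡a = fzero , fsuc j , fsuc k , s≤s z≤n , s≤s j<k , sym σₖ≡a , subst (x <_) (sym σⱼ≡b) a<b
⊆⇒Contains010 (x ∷ᵥ σ) a<b (_ ∷ʳ aba⊆) with ⊆⇒Contains010 σ a<b aba⊆
... | i , j , k , i<j , j<k , σᵢ≡σₖ , σᵢ<σⱼ = fsuc i , fsuc j , fsuc k , s≤s i<j , s≤s j<k , σᵢ≡σₖ , σᵢ<σⱼ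

Avoids010⇔ListAvoids010 : ∀ {n} (σ : Vec ℕ n) → Avoids010 σ ⇔ ListAvoids010 (toList σ)
Avoids010⇔ListAvoids010 σ = mk⇔ (λ avoids a b a<b aba⊆ → avoids (⊆⇒Contains010 σ a<b aba⊆))
                                (λ avoids contains → let a , b , a<b , aba⊆ = Contains010⇒⊆ σ contains in avoids a b a<b aba⊆)

AvoidingInvSeq : List ℕ → Set
AvoidingInvSeq v = IsInvSeqFrom 0 v × ListAvoids010 v

avoidingInvSeq? : ∀ v → Dec (AvoidingInvSeq v)
avoidingInvSeq? v = isInvSeqFrom? 0 v ×-dec listAvoids010? v

InBList : ℕ → ℕ → List ℕ → Set
InBList m d v = AvoidingInvSeq v × HasMaximum m v × distinct v ≡ d

inBList? : ∀ m d v → Dec (InBList m d v)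
inBList? m d v = avoidingInvSeq? v ×-dec (hasMaximum? m v ×-dec (distinct v ≟ d))

AvoidingInvSeq⇔ : ∀ {n} (σ : Vec ℕ n) → (IsInvSeq σ × Avoids010 σ) ⇔ AvoidingInvSeq (toList σ)
AvoidingInvSeq⇔ σ = mk⇔ (λ (inv , avoids) → IsInvSeqFrom-toList⁺ 0 σ inv , Equivalence.to (Avoids010⇔ListAvoids010 σ) avoids)
                        (λ (inv , avoids) → IsInvSeqFrom-toList⁻ 0 σ inv , Equivalence.from (Avoids010⇔ListAvoids010 σ) avoids)

InB⇔InBList : ∀ {n} m d (σ : Vec ℕ n) → InB n m d σ ⇔ InBList m d (toList σ)
InB⇔InBList m d σ = mk⇔
  (λ (inv , avoids , (σ≤m , m∈σ) , distinct≡d) →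
     Equivalence.to (AvoidingInvSeq⇔ σ) (inv , avoids) ,
     (All-toList⁺ σ σ≤m , let i , σᵢ≡m = m∈σ in subst (_∈ toList σ) σᵢ≡m (∈-toList⁺ (∈-lookup i σ))) ,
     trans (sym (length-deduplicate (toList σ))) distinct≡d)
  (λ (avoiding , (σ≤m , m∈σ) , distinct≡d) →
     let inv , avoids = Equivalence.from (AvoidingInvSeq⇔ σ) avoiding
     in inv , avoids , (All-toList⁻ σ σ≤m , ∈-toList⇒lookup σ m∈σ) , trans (length-deduplicate (toList σ)) distinct≡d)

b≡∑words : ∀ n m d → b n m d ≡ ∑[ v ← words n n ] 𝟙 (inBList? m d v)
b≡∑words n m d = begin
  b n m d                                          ≡⟨ length-filter≡∑𝟙 (inB? n m d) (allVecs n n) ⟩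
  ∑[ σ ← allVecs n n ] 𝟙 (inB? n m d σ)             ≡⟨ ∑-cong (allVecs n n) (λ σ → 𝟙-cong (InB⇔InBList m d σ) _ _) ⟩
  ∑[ σ ← allVecs n n ] 𝟙 (inBList? m d (toList σ))  ≡⟨ ∑-allVecs n n _ ⟩
  ∑[ v ← words n n ] 𝟙 (inBList? m d v)             ∎
  where open ≡-Reasoning

avoidCount≡∑words : ∀ n → avoidCount n ≡ ∑[ v ← words n n ] 𝟙 (avoidingInvSeq? v)
avoidCount≡∑words n = begin
  avoidCount n                                               ≡⟨ length-filter≡∑𝟙 _ (allVecs n n) ⟩
  ∑[ σ ← allVecs n n ] 𝟙 (isInvSeq? σ ×-dec avoids010? σ)     ≡⟨ ∑-cong (allVecs n n) (λ σ → 𝟙-cong (AvoidingInvSeq⇔ σ) _ _) ⟩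
  ∑[ σ ← allVecs n n ] 𝟙 (avoidingInvSeq? (toList σ))         ≡⟨ ∑-allVecs n n _ ⟩
  ∑[ v ← words n n ] 𝟙 (avoidingInvSeq? v)                    ∎
  where open ≡-Reasoning

WithDistinct : ℕ → List ℕ → Set
WithDistinct d v = AvoidingInvSeq v × distinct v ≡ d

withDistinct? : ∀ d v → Dec (WithDistinct d v)
withDistinct? d v = avoidingInvSeq? v ×-dec (distinct v ≟ d)

𝟙-inBList-∷ : ∀ j d y ys → let v = y ∷ ys in 𝟙 (inBList? j d v) ≡ 𝟙 (j ≟ maximum v) * 𝟙 (withDistinct? d v)
𝟙-inBList-∷ j d y ys = trans
  (𝟙-cong (mk⇔ (λ (A , max , d≡) → sym (HasMaximum⇒≡maximum max) , A , d≡)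
               (λ { (refl , A , d≡) → A , hasMaximum-maximum y ys , d≡ }))
          (inBList? j d (y ∷ ys)) ((j ≟ maximum (y ∷ ys)) ×-dec withDistinct? d (y ∷ ys)))
  (𝟙-× (j ≟ maximum (y ∷ ys)) (withDistinct? d (y ∷ ys)))

∑-inBList-below : ∀ M d y ys → let v = y ∷ ys in
                  maximum v < M → ∑[ j ← upTo M ] 𝟙 (inBList? j d v) ≡ 𝟙 (withDistinct? d v)
∑-inBList-below M d y ys max<M =
  trans (∑-cong (upTo M) (λ j → 𝟙-inBList-∷ j d y ys)) (∑-δ M (maximum (y ∷ ys)) _ max<M)

∑-inBList-above : ∀ M d y ys → let v = y ∷ ys in
                  M ≤ maximum v → ∑[ j ← upTo M ] 𝟙 (inBList? j d v) ≡ 0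
∑-inBList-above M d y ys M≤max =
  trans (∑-cong (upTo M) (λ j → 𝟙-inBList-∷ j d y ys)) (∑-δ-out M (maximum (y ∷ ys)) _ M≤max)

-- Every 010-avoiding inversion sequence of length n has exactly one maximum m < n and one count d ≤ n.
𝟙-avoidingInvSeq≡∑∑ : ∀ n v → length v ≡ suc n →
  𝟙 (avoidingInvSeq? v) ≡ ∑[ m ← upTo (suc n) ] ∑[ d ← upTo (suc (suc n)) ] 𝟙 (inBList? m d v)
𝟙-avoidingInvSeq≡∑∑ n (y ∷ ys) ∣v∣≡ = byAvoiding (avoidingInvSeq? (y ∷ ys))
  where
  v = y ∷ ys
  byAvoiding : (A? : Dec (AvoidingInvSeq v)) →
               𝟙 A? ≡ ∑[ m ← upTo (suc n) ] ∑[ d ← upTo (suc (suc n)) ] 𝟙 (inBList? m d v)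
  byAvoiding (no ¬A) = sym (∑-zero (upTo (suc n)) (λ m → ∑-zero (upTo (suc (suc n))) (λ d → 𝟙-no (inBList? m d v) (¬A ∘ proj₁))))
  byAvoiding (yes A@(inv , _)) = sym (begin
    ∑[ m ← upTo (suc n) ] ∑[ d ← upTo (suc (suc n)) ] 𝟙 (inBList? m d v)
      ≡⟨ ∑-comm (upTo (suc n)) (upTo (suc (suc n))) (λ m d → 𝟙 (inBList? m d v)) ⟩
    ∑[ d ← upTo (suc (suc n)) ] ∑[ m ← upTo (suc n) ] 𝟙 (inBList? m d v)
      ≡⟨ ∑-cong (upTo (suc (suc n))) (λ d → ∑-inBList-below (suc n) d y ys max<) ⟩
    ∑[ d ← upTo (suc (suc n)) ] 𝟙 (withDistinct? d v)
      ≡⟨ ∑-cong (upTo (suc (suc n))) 𝟙-withDistinct ⟩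
    ∑[ d ← upTo (suc (suc n)) ] (𝟙 (d ≟ distinct v) * 1)
      ≡⟨ ∑-δ (suc (suc n)) (distinct v) _ (s≤s (subst (distinct v ≤_) ∣v∣≡ (distinct≤length v))) ⟩
    1
      ∎)
    where
    open ≡-Reasoning
    max< : maximum v < suc n
    max< = maximum-< y ys (subst (λ k → All (_< k) v) ∣v∣≡ (IsInvSeqFrom⇒< 0 v inv))
    𝟙-withDistinct : ∀ d → 𝟙 (withDistinct? d v) ≡ 𝟙 (d ≟ distinct v) * 1
    𝟙-withDistinct d = trans (𝟙-cong (mk⇔ (sym ∘ proj₂) (λ d≡ → A , sym d≡)) (withDistinct? d v) (d ≟ distinct v)) (sym (*-identityʳ _))

avoidCount≡∑∑b : ∀ n → 1 ≤ n → avoidCount n ≡ sumFromTo 0 (n ∸ 1) (λ m → sumFromTo 0 n (λ d → b n m d))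
avoidCount≡∑∑b (suc n) _ = begin
  avoidCount (suc n)
    ≡⟨ avoidCount≡∑words (suc n) ⟩
  ∑[ v ← words (suc n) (suc n) ] 𝟙 (avoidingInvSeq? v)
    ≡⟨ ∑-words-cong (suc n) (suc n) (λ v ∣v∣≡ _ → 𝟙-avoidingInvSeq≡∑∑ n v ∣v∣≡) ⟩
  ∑[ v ← words (suc n) (suc n) ] ∑[ m ← upTo (suc n) ] ∑[ d ← upTo (suc (suc n)) ] 𝟙 (inBList? m d v)
    ≡⟨ ∑-comm (words (suc n) (suc n)) (upTo (suc n)) (λ v m → ∑[ d ← upTo (suc (suc n)) ] 𝟙 (inBList? m d v)) ⟩
  ∑[ m ← upTo (suc n) ] ∑[ v ← words (suc n) (suc n) ] ∑[ d ← upTo (suc (suc n)) ] 𝟙 (inBList? m d v)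
    ≡⟨ ∑-cong (upTo (suc n)) (λ m → ∑-comm (words (suc n) (suc n)) (upTo (suc (suc n))) (λ v d → 𝟙 (inBList? m d v))) ⟩
  ∑[ m ← upTo (suc n) ] ∑[ d ← upTo (suc (suc n)) ] ∑[ v ← words (suc n) (suc n) ] 𝟙 (inBList? m d v)
    ≡⟨ ∑-cong (upTo (suc n)) (λ m → ∑-cong (upTo (suc (suc n))) (λ d → b≡∑words (suc n) m d)) ⟨
  ∑[ m ← upTo (suc n) ] ∑[ d ← upTo (suc (suc n)) ] b (suc n) m d
    ∎
  where open ≡-Reasoning

-- Stirling numbers and the closed forms

stirling1-above : ∀ n k → n < k → stirling1 n k ≡ 0
stirling1-above zero    (suc k) _         = refl
stirling1-above (suc n) (suc k) (s≤s n<k)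
  rewrite stirling1-above n (suc k) (m<n⇒m<1+n n<k) | stirling1-above n k n<k | *-zeroʳ n = refl

stirling1-diagonal : ∀ n → stirling1 n n ≡ 1
stirling1-diagonal zero = refl
stirling1-diagonal (suc n) rewrite stirling1-above n (suc n) (n<1+n n) | stirling1-diagonal n | *-zeroʳ n = refl

-- The recurrence [L+2, k] = L+1 [L+1, k] + [L+1, k-1] at k = L+1-j; for j > L both sides vanish.
stirling1-suc-∸ : ∀ L j → stirling1 (suc (suc L)) (suc L ∸ j) ≡ stirling1 (suc L) (L ∸ j) + suc L * stirling1 (suc L) (suc L ∸ j)
stirling1-suc-∸ L j with j ≤? L
... | yes j≤L rewrite +-∸-assoc 1 j≤L = +-comm (suc L * stirling1 (suc L) (suc (L ∸ j))) _
... | no j≰L rewrite m≤n⇒m∸n≡0 (≰⇒> j≰L) | m≤n⇒m∸n≡0 (<⇒≤ (≰⇒> j≰L)) | *-zeroʳ L = refl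

-- Closed forms for the number of 010-avoiding tails of length L with k distinct values, over t letters
-- below the top (all tails, resp. those using a given least letter).
tailCount : ℕ → ℕ → ℕ → ℕ
tailCount t L k = (t C (k ∸ 1)) * stirling1 (suc L) ((2 + L) ∸ k)

tailWithCount : ℕ → ℕ → ℕ → ℕ
tailWithCount t L zero          = 0
tailWithCount t L (suc zero)    = 0
tailWithCount t L (suc (suc k)) = (t C k) * stirling1 (suc L) (L ∸ k)

tailCount-suc : ∀ t L k → tailCount (suc t) L k ≡ tailCount t L k + tailWithCount t L k
tailCount-suc t L zero          = sym (+-identityʳ _)
tailCount-suc t L (suc zero)    = sym (+-identityʳ _)
tailCount-suc t L (suc (suc k)) = begin
  (suc t C suc k) * s                   ≡⟨ cong (_* s) (nCk+nC[k+1]≡[n+1]C[k+1] t k) ⟨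
  ((t C k) + (t C suc k)) * s           ≡⟨ *-distribʳ-+ s (t C k) _ ⟩
  (t C k) * s + (t C suc k) * s         ≡⟨ +-comm ((t C k) * s) _ ⟩
  (t C suc k) * s + (t C k) * s         ∎
  where
  open ≡-Reasoning
  s = stirling1 (suc L) (L ∸ k)

tailWithCount-suc : ∀ t L k → tailWithCount t (suc L) (suc k) ≡ tailWithCount t L (suc k) + suc L * tailCount t L k
tailWithCount-suc t L zero    = sym (trans (cong (λ s → suc L * (1 * s)) (stirling1-above (suc L) (suc (suc L)) (n<1+n (suc L)))) (*-zeroʳ (suc L)))
tailWithCount-suc t L (suc k) = begin
  c * stirling1 (suc (suc L)) (suc L ∸ k)   ≡⟨ cong (c *_) (stirling1-suc-∸ L k) ⟩
  c * (s₁ + suc L * s₂)                     ≡⟨ *-distribˡ-+ c s₁ _ ⟩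
  c * s₁ + c * (suc L * s₂)                 ≡⟨ cong (c * s₁ +_) (*-left-comm c (suc L) s₂) ⟩
  c * s₁ + suc L * (c * s₂)                 ∎
  where
  open ≡-Reasoning
  c  = t C k
  s₁ = stirling1 (suc L) (L ∸ k)
  s₂ = stirling1 (suc L) (suc L ∸ k)

tailWithCount-0 : ∀ t k → tailWithCount t 0 k ≡ 0
tailWithCount-0 t zero          = refl
tailWithCount-0 t (suc zero)    = refl
tailWithCount-0 t (suc (suc k)) rewrite 0∸n≡0 k = *-zeroʳ (t C k)

module Tails (K m : ℕ) (u : List ℕ) (m<K : m < K) where

  -- A tail follows the first occurrence of the maximum m; its letters are m itself or values in [lo, m)
  -- that do not occur in the prefix u.
  Allowed : ℕ → ℕ → Set
  Allowed lo y = y ≡ m ⊎ (lo ≤ y × y < m × y ∉ u)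

  allowed? : ∀ lo y → Dec (Allowed lo y)
  allowed? lo y = (y ≟ m) ⊎-dec ((lo ≤? y) ×-dec ((y <? m) ×-dec ¬? (y ∈? u)))

  IsTail : ℕ → ℕ → List ℕ → Set
  IsTail lo k β = All (Allowed lo) β × ListAvoids010 (m ∷ β) × distinct (m ∷ β) ≡ k

  isTail? : ∀ lo k β → Dec (IsTail lo k β)
  isTail? lo k β = all? (allowed? lo) β ×-dec (listAvoids010? (m ∷ β) ×-dec (distinct (m ∷ β) ≟ k))

  tails : ℕ → ℕ → ℕ → ℕ
  tails lo L k = ∑[ β ← words L K ] 𝟙 (isTail? lo k β)

  tailsWith : ℕ → ℕ → ℕ → ℕ
  tailsWith lo L k = ∑[ β ← words L K ] (𝟙 (lo ∈? β) * 𝟙 (isTail? lo k β))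

  tailsWith-0 : ∀ lo L → tailsWith lo L 0 ≡ 0
  tailsWith-0 lo L = ∑-zero (words L K) (λ β → trans (cong (𝟙 (lo ∈? β) *_) (𝟙-no (isTail? lo 0 β) ¬IsTail-0))
                                                     (*-zeroʳ (𝟙 (lo ∈? β))))
    where
    ¬IsTail-0 : ∀ {β} → ¬ IsTail lo 0 β
    ¬IsTail-0 {β} (_ , _ , distinct≡0) = 1+n≰n (subst (1 ≤_) distinct≡0 (1≤distinct-∷ m β))

  module LeastLetter (x : ℕ) (x∉u : x ∉ u) (x<m : x < m) where

    x≢m : x ≢ m
    x≢m = <⇒≢ x<m

    x-allowed : Allowed x x
    x-allowed = inj₂ (≤-refl , x<m , x∉u)

    x≤-allowed : ∀ {v} → All (Allowed x) v → All (x ≤_) (m ∷ v)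
    x≤-allowed allowed = <⇒≤ x<m ∷ All.map (λ { (inj₁ refl) → <⇒≤ x<m ; (inj₂ (x≤y , _)) → x≤y }) allowed

    raise : ∀ {v} → All (Allowed x) v → x ∉ v → All (Allowed (suc x)) v
    raise []                              _   = []
    raise (inj₁ y≡m ∷ allowed)            x∉v = inj₁ y≡m ∷ raise allowed (x∉v ∘ there)
    raise (inj₂ (x≤y , y<m , y∉u) ∷ allowed) x∉v =
      inj₂ (≤∧≢⇒< x≤y (x∉v ∘ here) , y<m , y∉u) ∷ raise allowed (x∉v ∘ there)

    lower : ∀ {v} → All (Allowed (suc x)) v → All (Allowed x) v
    lower = All.map (λ { (inj₁ y≡m) → inj₁ y≡m ; (inj₂ (x<y , y<m , y∉u)) → inj₂ (<⇒≤ x<y , y<m , y∉u) })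

    raised-∉ : ∀ {v} → All (Allowed (suc x)) v → x ∉ v
    raised-∉ allowed x∈v with All.lookup allowed x∈v
    ... | inj₁ x≡m         = x≢m x≡m
    ... | inj₂ (x<x , _)   = <-irrefl refl x<x

    x∉m∷α : ∀ α → x ∉ α → x ∉ m ∷ α
    x∉m∷α α x∉α (here x≡m)  = x≢m x≡m
    x∉m∷α α x∉α (there x∈α) = x∉α x∈α

    ∉-m∷α++γ : ∀ α γ → x ∉ α → x ∉ γ → x ∉ m ∷ α ++ γ
    ∉-m∷α++γ α γ x∉α x∉γ = x∉m∷α (α ++ γ) ([ x∉α , x∉γ ]′ ∘ ∈-++⁻ α)

    ⊆-insert : ∀ α γ → m ∷ α ++ γ ⊆ m ∷ α ++ x ∷ γ
    ⊆-insert α γ = refl ∷ ++⁺ ⊆-refl (x ∷ʳ ⊆-refl)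

    -- x is the least letter, so an occurrence of 010 through x must use x as the outer letter.
    avoids-insert : ∀ α γ → All (x ≤_) (m ∷ α ++ x ∷ γ) → x ∉ α → x ∉ γ →
                    ListAvoids010 (m ∷ α ++ γ) → ListAvoids010 (m ∷ α ++ x ∷ γ)
    avoids-insert α γ x≤ x∉α x∉γ avoids a b a<b aba⊆ with a ≟ x | b ≟ x
    ... | yes refl | _       = x∉γ (second-occurrence (m ∷ α) (⊆-trans (refl ∷ (b ∷ʳ ⊆-refl)) aba⊆) (x∉m∷α α x∉α))
    ... | no a≢x   | yes refl = <⇒≱ a<b (All.lookup x≤ (to∈ aba⊆))
    ... | no a≢x   | no b≢x   = avoids a b a<b (⊆-delete (m ∷ α) aba⊆ (a≢x ∷ b≢x ∷ a≢x ∷ []))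

    avoids-duplicate : ∀ α γ → All (x ≤_) (m ∷ α ++ x ∷ x ∷ γ) → x ∉ α →
                       ListAvoids010 (m ∷ α ++ x ∷ γ) → ListAvoids010 (m ∷ α ++ x ∷ x ∷ γ)
    avoids-duplicate α γ x≤ x∉α avoids a b a<b aba⊆ with a ≟ x | b ≟ x
    ... | yes refl | _       = avoids x b a<b (++⁺ˡ (m ∷ α) (undouble (⊆-skipPrefix (m ∷ α) aba⊆ (x∉m∷α α x∉α))))
      where
      undouble : x ∷ b ∷ x ∷ [] ⊆ x ∷ x ∷ γ → x ∷ b ∷ x ∷ [] ⊆ x ∷ γ
      undouble (refl ∷ refl ∷ _) = ⊥-elim (<-irrefl refl a<b)
      undouble (refl ∷ _ ∷ʳ bx⊆) = refl ∷ bx⊆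
      undouble (_ ∷ʳ xbx⊆)       = xbx⊆
    ... | no a≢x   | yes refl = <⇒≱ a<b (All.lookup x≤ (to∈ aba⊆))
    ... | no a≢x   | no b≢x   = avoids a b a<b (⊆-delete (m ∷ α) aba⊆ (a≢x ∷ b≢x ∷ a≢x ∷ []))

    distinct-duplicate : ∀ α γ → distinct (m ∷ α ++ x ∷ x ∷ γ) ≡ distinct (m ∷ α ++ x ∷ γ)
    distinct-duplicate α γ = begin
      distinct (m ∷ α ++ x ∷ x ∷ γ)
        ≡⟨ distinct-insert (m ∷ α) x (x ∷ γ) ⟩
      distinct (m ∷ α ++ x ∷ γ) + 𝟙 (¬? (x ∈? (m ∷ α ++ x ∷ γ)))
        ≡⟨ cong (distinct (m ∷ α ++ x ∷ γ) +_) (𝟙-no (¬? (x ∈? (m ∷ α ++ x ∷ γ))) (λ x∉ → x∉ (there (∈-++⁺ʳ α (here refl))))) ⟩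
      distinct (m ∷ α ++ x ∷ γ) + 0
        ≡⟨ +-identityʳ _ ⟩
      distinct (m ∷ α ++ x ∷ γ)
        ∎
      where open ≡-Reasoning

    distinct-insert-new : ∀ α γ → x ∉ α → x ∉ γ → distinct (m ∷ α ++ x ∷ γ) ≡ suc (distinct (m ∷ α ++ γ))
    distinct-insert-new α γ x∉α x∉γ = begin
      distinct (m ∷ α ++ x ∷ γ)
        ≡⟨ distinct-insert (m ∷ α) x γ ⟩
      distinct (m ∷ α ++ γ) + 𝟙 (¬? (x ∈? (m ∷ α ++ γ)))
        ≡⟨ cong (distinct (m ∷ α ++ γ) +_) (𝟙-yes (¬? (x ∈? (m ∷ α ++ γ))) (∉-m∷α++γ α γ x∉α x∉γ)) ⟩
      distinct (m ∷ α ++ γ) + 1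
        ≡⟨ +-comm _ 1 ⟩
      suc (distinct (m ∷ α ++ γ))
        ∎
      where open ≡-Reasoning

    IsTail-duplicate : ∀ k α γ → x ∉ α → IsTail x k (α ++ x ∷ x ∷ γ) ⇔ IsTail x k (α ++ x ∷ γ)
    IsTail-duplicate k α γ x∉α = mk⇔
      (λ (allowed , avoids , distinct≡k) →
         proj₁ (All-insert⁻ α allowed) , listAvoids010-⊆ (⊆-insert α (x ∷ γ)) avoids ,
         trans (sym (distinct-duplicate α γ)) distinct≡k)
      (λ (allowed , avoids , distinct≡k) →
         let allowed′ = All-insert⁺ α allowed x-allowed
         in allowed′ , avoids-duplicate α γ (x≤-allowed allowed′) x∉α avoids , trans (distinct-duplicate α γ) distinct≡k)

    IsTail-remove : ∀ k α γ → x ∉ α → x ∉ γ → IsTail x (suc k) (α ++ x ∷ γ) ⇔ IsTail (suc x) k (α ++ γ)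
    IsTail-remove k α γ x∉α x∉γ = mk⇔
      (λ (allowed , avoids , distinct≡) →
         raise (proj₁ (All-insert⁻ α allowed)) (∉-m∷α++γ α γ x∉α x∉γ ∘ there) ,
         listAvoids010-⊆ (⊆-insert α γ) avoids ,
         suc-injective (trans (sym (distinct-insert-new α γ x∉α x∉γ)) distinct≡))
      (λ (allowed , avoids , distinct≡) →
         let allowed′ = All-insert⁺ α (lower allowed) x-allowed
         in allowed′ , avoids-insert α γ (x≤-allowed allowed′) x∉α x∉γ avoids ,
            trans (distinct-insert-new α γ x∉α x∉γ) (cong suc distinct≡))

    -- x is the least letter, so any letter y between two occurrences of x gives x y x.
    ¬IsTail-return : ∀ k α y γ → y ≢ x → x ∈ γ → ¬ IsTail x k (α ++ x ∷ y ∷ γ)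
    ¬IsTail-return k α y γ y≢x x∈γ (allowed , avoids , _) =
      avoids x y x<y (++⁺ˡ (m ∷ α) (refl ∷ refl ∷ from∈ x∈γ))
      where
      x<y : x < y
      x<y = ≤∧≢⇒< (All.lookup (x≤-allowed allowed) (there (∈-++⁺ʳ α (there (here refl))))) (y≢x ∘ sym)

    startsWithX : List ℕ → ℕ
    startsWithX []      = 0
    startsWithX (y ∷ _) = 𝟙 (y ≟ x)

    -- Cut at the first occurrence of x: the rest γ either repeats x at once, or never contains x again.
    𝟙-isTail-firstOccurrence : ∀ k α γ → x ∉ α →
      𝟙 (isTail? x (suc k) (α ++ x ∷ γ))
      ≡ startsWithX γ * 𝟙 (isTail? x (suc k) (α ++ γ)) + 𝟙 (¬? (x ∈? γ)) * 𝟙 (isTail? (suc x) k (α ++ γ))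
    𝟙-isTail-firstOccurrence k α []      x∉α =
      trans (𝟙-cong (IsTail-remove k α [] x∉α (λ ())) _ _) (sym (+-identityʳ _))
    𝟙-isTail-firstOccurrence k α (y ∷ γ) x∉α = byNext (y ≟ x) (x ∈? γ)
      where
      F F′ : ℕ
      F  = 𝟙 (isTail? x (suc k) (α ++ y ∷ γ))
      F′ = 𝟙 (isTail? (suc x) k (α ++ y ∷ γ))
      byNext : Dec (y ≡ x) → Dec (x ∈ γ) →
               𝟙 (isTail? x (suc k) (α ++ x ∷ y ∷ γ)) ≡ startsWithX (y ∷ γ) * F + 𝟙 (¬? (x ∈? (y ∷ γ))) * F′
      byNext (yes refl) _ = begin
        𝟙 (isTail? x (suc k) (α ++ x ∷ x ∷ γ))
          ≡⟨ 𝟙-cong (IsTail-duplicate (suc k) α γ x∉α) _ _ ⟩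
        F
          ≡⟨ trans (+-identityʳ (1 * F)) (*-identityˡ F) ⟨
        1 * F + 0 * F′
          ≡⟨ cong₂ (λ i j → i * F + j * F′) (𝟙-yes (x ≟ x) refl) (𝟙-no (¬? (x ∈? (x ∷ γ))) (λ x∉ → x∉ (here refl))) ⟨
        startsWithX (x ∷ γ) * F + 𝟙 (¬? (x ∈? (x ∷ γ))) * F′
          ∎
        where open ≡-Reasoning
      byNext (no y≢x) (yes x∈γ) = begin
        𝟙 (isTail? x (suc k) (α ++ x ∷ y ∷ γ))
          ≡⟨ 𝟙-no (isTail? x (suc k) (α ++ x ∷ y ∷ γ)) (¬IsTail-return (suc k) α y γ y≢x x∈γ) ⟩
        0
          ≡⟨ cong₂ (λ i j → i * F + j * F′) (𝟙-no (y ≟ x) y≢x) (𝟙-no (¬? (x ∈? (y ∷ γ))) (λ x∉ → x∉ (there x∈γ))) ⟨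
        startsWithX (y ∷ γ) * F + 𝟙 (¬? (x ∈? (y ∷ γ))) * F′
          ∎
        where open ≡-Reasoning
      byNext (no y≢x) (no x∉γ) = begin
        𝟙 (isTail? x (suc k) (α ++ x ∷ y ∷ γ))  ≡⟨ 𝟙-cong (IsTail-remove k α (y ∷ γ) x∉α x∉y∷γ) _ _ ⟩
        F′                                      ≡⟨ *-identityˡ F′ ⟨
        0 + 1 * F′                              ≡⟨ cong₂ (λ i j → i * F + j * F′) (𝟙-no (y ≟ x) y≢x) (𝟙-yes (¬? (x ∈? (y ∷ γ))) x∉y∷γ) ⟨
        startsWithX (y ∷ γ) * F + 𝟙 (¬? (x ∈? (y ∷ γ))) * F′ ∎
        where
        open ≡-Reasoning
        x∉y∷γ : x ∉ y ∷ γ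
        x∉y∷γ (here x≡y)  = y≢x (sym x≡y)
        x∉y∷γ (there x∈γ) = x∉γ x∈γ

    x<K : x < K
    x<K = <-trans x<m m<K

    ∑-startsWithX : ∀ n (g : List ℕ → ℕ) → ∑[ γ ← words (suc n) K ] (startsWithX γ * g γ) ≡ ∑[ γ ← words n K ] g (x ∷ γ)
    ∑-startsWithX n g = begin
      ∑[ γ ← words (suc n) K ] (startsWithX γ * g γ)                 ≡⟨ ∑-words-suc n K _ ⟩
      ∑[ y ← upTo K ] ∑[ γ ← words n K ] (𝟙 (y ≟ x) * g (y ∷ γ))     ≡⟨ ∑-cong (upTo K) (λ y → ∑-*ˡ (words n K) (𝟙 (y ≟ x)) (g ∘ (y ∷_))) ⟩
      ∑[ y ← upTo K ] (𝟙 (y ≟ x) * (∑[ γ ← words n K ] g (y ∷ γ)))   ≡⟨ ∑-δ K x _ x<K ⟩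
      ∑[ γ ← words n K ] g (x ∷ γ)                                  ∎
      where open ≡-Reasoning

    module _ (L k : ℕ) where

      private
        F F′ : List ℕ → ℕ
        F  β = 𝟙 (isTail? x (suc k) β)
        F′ β = 𝟙 (isTail? (suc x) k β)

      repeated : ℕ → ℕ
      repeated a = ∑[ α ← words a K ] (𝟙 (¬? (x ∈? α)) * (∑[ γ ← words (L ∸ a) K ] (startsWithX γ * F (α ++ γ))))

      removed : ℕ → ℕ
      removed a = ∑[ α ← words a K ] (𝟙 (¬? (x ∈? α)) * (∑[ γ ← words (L ∸ a) K ] (𝟙 (¬? (x ∈? γ)) * F′ (α ++ γ))))

      tailsWith-split : tailsWith x (suc L) (suc k) ≡ ∑ (upTo (suc L)) repeated + ∑ (upTo (suc L)) removed
      tailsWith-split = begin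
        tailsWith x (suc L) (suc k)
          ≡⟨ ∑-words-firstOccurrence x<K (suc L) F ⟩
        ∑[ a ← upTo (suc L) ] ∑[ α ← words a K ] (𝟙 (¬? (x ∈? α)) * (∑[ γ ← words (L ∸ a) K ] F (α ++ x ∷ γ)))
          ≡⟨ ∑-cong (upTo (suc L)) (λ a → ∑-cong (words a K) (λ α → 𝟙-*-cong (¬? (x ∈? α)) (λ x∉α →
               ∑-cong (words (L ∸ a) K) (λ γ → 𝟙-isTail-firstOccurrence k α γ x∉α)))) ⟩
        ∑[ a ← upTo (suc L) ] ∑[ α ← words a K ] (𝟙 (¬? (x ∈? α)) *
          (∑[ γ ← words (L ∸ a) K ] (startsWithX γ * F (α ++ γ) + 𝟙 (¬? (x ∈? γ)) * F′ (α ++ γ))))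
          ≡⟨ ∑-cong (upTo (suc L)) (λ a → trans (∑-cong (words a K) (λ α →
               trans (cong (𝟙 (¬? (x ∈? α)) *_) (∑-distrib-+ (words (L ∸ a) K) _ _)) (*-distribˡ-+ (𝟙 (¬? (x ∈? α))) _ _)))
               (∑-distrib-+ (words a K) _ _)) ⟩
        ∑[ a ← upTo (suc L) ] (repeated a + removed a)
          ≡⟨ ∑-distrib-+ (upTo (suc L)) repeated removed ⟩
        ∑ (upTo (suc L)) repeated + ∑ (upTo (suc L)) removed
          ∎
        where open ≡-Reasoning

      ∑-repeated : ∑ (upTo (suc L)) repeated ≡ tailsWith x L (suc k)
      ∑-repeated = begin
        ∑ (upTo (suc L)) repeated
          ≡⟨ ∑-upTo-snoc L repeated ⟩
        ∑ (upTo L) repeated + repeated L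
          ≡⟨ cong₂ _+_ (∑-cong-∈ (upTo L) (λ a a∈ → ∑-cong (words a K) (λ α → cong (𝟙 (¬? (x ∈? α)) *_) (shorten a (∈-upTo⁻ a∈) α))))
                       (∑-zero (words L K) (λ α → trans (cong (λ n → 𝟙 (¬? (x ∈? α)) * (∑[ γ ← words n K ] (startsWithX γ * F (α ++ γ)))) (n∸n≡0 L))
                                                        (*-zeroʳ (𝟙 (¬? (x ∈? α)))))) ⟩
        (∑[ a ← upTo L ] ∑[ α ← words a K ] (𝟙 (¬? (x ∈? α)) * (∑[ γ ← words (L ∸ suc a) K ] F (α ++ x ∷ γ)))) + 0
          ≡⟨ +-identityʳ _ ⟩
        ∑[ a ← upTo L ] ∑[ α ← words a K ] (𝟙 (¬? (x ∈? α)) * (∑[ γ ← words (L ∸ suc a) K ] F (α ++ x ∷ γ)))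
          ≡⟨ ∑-words-firstOccurrence x<K L F ⟨
        tailsWith x L (suc k)
          ∎
        where
        open ≡-Reasoning
        shorten : ∀ a → a < L → ∀ α → ∑[ γ ← words (L ∸ a) K ] (startsWithX γ * F (α ++ γ)) ≡ ∑[ γ ← words (L ∸ suc a) K ] F (α ++ x ∷ γ)
        shorten a a<L α rewrite +-∸-assoc 1 a<L = ∑-startsWithX (L ∸ suc a) (F ∘ (α ++_))

      ∑-removed : ∑ (upTo (suc L)) removed ≡ suc L * tails (suc x) L k
      ∑-removed = begin
        ∑ (upTo (suc L)) removed                           ≡⟨ ∑-cong-∈ (upTo (suc L)) (λ a a∈ → removed≡tails a (≤-pred (∈-upTo⁻ a∈))) ⟩
        ∑[ _ ← upTo (suc L) ] tails (suc x) L k            ≡⟨ ∑-const (upTo (suc L)) _ ⟩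
        length (upTo (suc L)) * tails (suc x) L k          ≡⟨ cong (_* tails (suc x) L k) (length-upTo (suc L)) ⟩
        suc L * tails (suc x) L k                          ∎
        where
        open ≡-Reasoning
        -- Tails over the letters above x avoid x, so the indicators 𝟙 (x ∉ α) and 𝟙 (x ∉ γ) are redundant.
        𝟙-x∉-redundant : ∀ α γ → 𝟙 (¬? (x ∈? α)) * (𝟙 (¬? (x ∈? γ)) * F′ (α ++ γ)) ≡ F′ (α ++ γ)
        𝟙-x∉-redundant α γ with isTail? (suc x) k (α ++ γ)
        ... | no _ = trans (cong (𝟙 (¬? (x ∈? α)) *_) (*-zeroʳ (𝟙 (¬? (x ∈? γ))))) (*-zeroʳ (𝟙 (¬? (x ∈? α))))
        ... | yes (allowed , _) = cong₂ (λ i j → i * (j * 1)) (𝟙-yes (¬? (x ∈? α)) (raised-∉ allowed ∘ ∈-++⁺ˡ))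
                                                                (𝟙-yes (¬? (x ∈? γ)) (raised-∉ allowed ∘ ∈-++⁺ʳ α))
        removed≡tails : ∀ a → a ≤ L → removed a ≡ tails (suc x) L k
        removed≡tails a a≤L = begin
          removed a                                                   ≡⟨ ∑-cong (words a K) (λ α → sym (∑-*ˡ (words (L ∸ a) K) (𝟙 (¬? (x ∈? α))) _)) ⟩
          ∑[ α ← words a K ] ∑[ γ ← words (L ∸ a) K ] (𝟙 (¬? (x ∈? α)) * (𝟙 (¬? (x ∈? γ)) * F′ (α ++ γ)))
            ≡⟨ ∑-cong (words a K) (λ α → ∑-cong (words (L ∸ a) K) (𝟙-x∉-redundant α)) ⟩
          ∑[ α ← words a K ] ∑[ γ ← words (L ∸ a) K ] F′ (α ++ γ)     ≡⟨ ∑-words-++ a (L ∸ a) K F′ ⟨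
          ∑ (words (a + (L ∸ a)) K) F′                                ≡⟨ cong (λ n → ∑ (words n K) F′) (m+[n∸m]≡n a≤L) ⟩
          tails (suc x) L k                                           ∎

      tailsWith-suc : tailsWith x (suc L) (suc k) ≡ tailsWith x L (suc k) + suc L * tails (suc x) L k
      tailsWith-suc = trans tailsWith-split (cong₂ _+_ ∑-repeated ∑-removed)

    tails-split : ∀ L k → tails x L k ≡ tails (suc x) L k + tailsWith x L k
    tails-split L k = trans (∑-cong (words L K) byOccurrence) (∑-distrib-+ (words L K) _ _)
      where
      byOccurrence : ∀ β → 𝟙 (isTail? x k β) ≡ 𝟙 (isTail? (suc x) k β) + 𝟙 (x ∈? β) * 𝟙 (isTail? x k β)
      byOccurrence β = begin
        𝟙 (isTail? x k β)                                                    ≡⟨ *-identityˡ _ ⟨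
        1 * 𝟙 (isTail? x k β)                                                ≡⟨ cong (_* 𝟙 (isTail? x k β)) (𝟙-¬ (x ∈? β)) ⟨
        (𝟙 (¬? (x ∈? β)) + 𝟙 (x ∈? β)) * 𝟙 (isTail? x k β)                   ≡⟨ *-distribʳ-+ (𝟙 (isTail? x k β)) (𝟙 (¬? (x ∈? β))) _ ⟩
        𝟙 (¬? (x ∈? β)) * 𝟙 (isTail? x k β) + 𝟙 (x ∈? β) * 𝟙 (isTail? x k β) ≡⟨ cong (_+ 𝟙 (x ∈? β) * 𝟙 (isTail? x k β)) without-x ⟩
        𝟙 (isTail? (suc x) k β) + 𝟙 (x ∈? β) * 𝟙 (isTail? x k β)             ∎
        where
        open ≡-Reasoning
        without-x : 𝟙 (¬? (x ∈? β)) * 𝟙 (isTail? x k β) ≡ 𝟙 (isTail? (suc x) k β)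
        without-x = trans (sym (𝟙-× (¬? (x ∈? β)) (isTail? x k β)))
                          (𝟙-cong (mk⇔ (λ (x∉β , allowed , rest) → raise allowed x∉β , rest)
                                       (λ (allowed , rest) → raised-∉ allowed , lower allowed , rest)) _ _)

  available : ℕ → ℕ → ℕ
  available lo r = ∑[ j ← upTo r ] 𝟙 (¬? ((lo + j) ∈? u))

  available-suc : ∀ lo r → available lo (suc r) ≡ 𝟙 (¬? (lo ∈? u)) + available (suc lo) r
  available-suc lo r = trans (∑-upTo-suc r _) (cong₂ _+_ (cong (λ z → 𝟙 (¬? (z ∈? u))) (+-identityʳ lo))
                                                       (∑-cong (upTo r) (λ j → cong (λ z → 𝟙 (¬? (z ∈? u))) (+-suc lo j))))

  tails-onlyTop : ∀ L k → tails m L k ≡ tailCount 0 L k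
  tails-onlyTop L k = begin
    tails m L k
      ≡⟨ ∑-cong (words L K) (λ β → trans (𝟙-cong (constant⇔ β) _ _) (𝟙-× (all? (_≟ m) β) (1 ≟ k))) ⟩
    ∑[ β ← words L K ] (𝟙 (all? (_≟ m) β) * 𝟙 (1 ≟ k))
      ≡⟨ ∑-*ʳ (words L K) (𝟙 (1 ≟ k)) _ ⟩
    (∑[ β ← words L K ] 𝟙 (all? (_≟ m) β)) * 𝟙 (1 ≟ k)
      ≡⟨ cong (_* 𝟙 (1 ≟ k)) (∑-words-constant L K m m<K) ⟩
    1 * 𝟙 (1 ≟ k)
      ≡⟨ closedForm k ⟩
    tailCount 0 L k
      ∎
    where
    open ≡-Reasoning
    distinct-constant : ∀ β → All (_≡ m) β → distinct (m ∷ β) ≡ 1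
    distinct-constant []      _              = refl
    distinct-constant (_ ∷ β) (refl ∷ β≡m) =
      trans (cong (_+ distinct (m ∷ β)) (𝟙-no (¬? (m ∈? (m ∷ β))) (λ m∉ → m∉ (here refl)))) (distinct-constant β β≡m)
    avoids-constant : ∀ β → All (_≡ m) β → ListAvoids010 (m ∷ β)
    avoids-constant β β≡m a b a<b aba⊆ =
      <-irrefl (trans (All.lookup (refl ∷ β≡m) (to∈ aba⊆)) (sym (All.lookup (refl ∷ β≡m) (to∈ (∷ˡ⁻ aba⊆))))) a<b
    only-m : ∀ {y} → Allowed m y → y ≡ m
    only-m (inj₁ y≡m)             = y≡m
    only-m (inj₂ (m≤y , y<m , _)) = ⊥-elim (<⇒≱ y<m m≤y)
    constant⇔ : ∀ β → IsTail m k β ⇔ (All (_≡ m) β × 1 ≡ k)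
    constant⇔ β = mk⇔
      (λ (allowed , _ , distinct≡k) → let β≡m = All.map only-m allowed in β≡m , trans (sym (distinct-constant β β≡m)) distinct≡k)
      (λ (β≡m , 1≡k) → All.map inj₁ β≡m , avoids-constant β β≡m , trans (distinct-constant β β≡m) 1≡k)
    closedForm : ∀ k → 1 * 𝟙 (1 ≟ k) ≡ tailCount 0 L k
    closedForm zero          = sym (trans (*-identityˡ _) (stirling1-above (suc L) (suc (suc L)) (n<1+n (suc L))))
    closedForm (suc zero)    = sym (trans (+-identityʳ _) (stirling1-diagonal (suc L)))
    closedForm (suc (suc k)) = refl

  tails-skip : ∀ lo L k → lo ∈ u → tails lo L k ≡ tails (suc lo) L k
  tails-skip lo L k lo∈u = ∑-cong (words L K) (λ β → 𝟙-cong (mk⇔ (λ (allowed , rest) → All.map up allowed , rest)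
                                                                 (λ (allowed , rest) → All.map down allowed , rest)) _ _)
    where
    up : ∀ {y} → Allowed lo y → Allowed (suc lo) y
    up (inj₁ y≡m)                 = inj₁ y≡m
    up (inj₂ (lo≤y , y<m , y∉u))  = inj₂ (≤∧≢⇒< lo≤y (λ { refl → y∉u lo∈u }) , y<m , y∉u)
    down : ∀ {y} → Allowed (suc lo) y → Allowed lo y
    down (inj₁ y≡m)               = inj₁ y≡m
    down (inj₂ (lo<y , y<m , y∉u)) = inj₂ (<⇒≤ lo<y , y<m , y∉u)

  tails≡tailCount : ∀ r lo → lo + r ≡ m → ∀ L k → tails lo L k ≡ tailCount (available lo r) L k
  tails≡tailCount zero    lo lo+0≡m L k rewrite trans (sym (+-identityʳ lo)) lo+0≡m = tails-onlyTop L k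
  tails≡tailCount (suc r) lo lo+r≡m L k with lo ∈? u
  ... | yes lo∈u = begin
    tails lo L k
      ≡⟨ tails-skip lo L k lo∈u ⟩
    tails (suc lo) L k
      ≡⟨ IH L k ⟩
    tailCount (available (suc lo) r) L k
      ≡⟨ cong (λ t → tailCount t L k) (trans (available-suc lo r) (cong (_+ available (suc lo) r) (𝟙-no (¬? (lo ∈? u)) (λ lo∉u → lo∉u lo∈u)))) ⟨
    tailCount (available lo (suc r)) L k
      ∎
    where
    open ≡-Reasoning
    IH = tails≡tailCount r (suc lo) (trans (sym (+-suc lo r)) lo+r≡m)
  ... | no lo∉u = begin
    tails lo L k
      ≡⟨ tails-split L k ⟩
    tails (suc lo) L k + tailsWith lo L k
      ≡⟨ cong₂ _+_ (IH L k) (tailsWith≡tailWithCount L k) ⟩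
    tailCount t L k + tailWithCount t L k
      ≡⟨ tailCount-suc t L k ⟨
    tailCount (suc t) L k
      ≡⟨ cong (λ t′ → tailCount t′ L k) (trans (available-suc lo r) (cong (_+ t) (𝟙-yes (¬? (lo ∈? u)) lo∉u))) ⟨
    tailCount (available lo (suc r)) L k
      ∎
    where
    open ≡-Reasoning
    t = available (suc lo) r
    IH = tails≡tailCount r (suc lo) (trans (sym (+-suc lo r)) lo+r≡m)
    lo<m : lo < m
    lo<m = subst (lo <_) lo+r≡m (m<m+n lo (s≤s z≤n))
    open LeastLetter lo lo∉u lo<m
    tailsWith≡tailWithCount : ∀ L k → tailsWith lo L k ≡ tailWithCount t L k
    tailsWith≡tailWithCount zero    k       = sym (tailWithCount-0 t k)
    tailsWith≡tailWithCount (suc L) zero    = tailsWith-0 lo (suc L)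
    tailsWith≡tailWithCount (suc L) (suc k) = begin
      tailsWith lo (suc L) (suc k)                          ≡⟨ tailsWith-suc L k ⟩
      tailsWith lo L (suc k) + suc L * tails (suc lo) L k   ≡⟨ cong₂ _+_ (tailsWith≡tailWithCount L (suc k)) (cong (suc L *_) (IH L k)) ⟩
      tailWithCount t L (suc k) + suc L * tailCount t L k   ≡⟨ tailWithCount-suc t L k ⟨
      tailWithCount t (suc L) (suc k)                       ∎

module Decomposition (n m : ℕ) (m<n : m < n) (1≤m : 1 ≤ m) where

  module TailsAfter (u : List ℕ) = Tails n m u m<n
  open TailsAfter using (Allowed; allowed?; isTail?; tails; available; tails≡tailCount)

  IsPrefix : List ℕ → Set
  IsPrefix u = AvoidingInvSeq u × All (_< m) u

  isPrefix? : ∀ u → Dec (IsPrefix u)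
  isPrefix? u = avoidingInvSeq? u ×-dec all? (_<? m) u

  prefix? : ∀ i u → Dec (IsPrefix u × distinct u ≡ i)
  prefix? i u = isPrefix? u ×-dec (distinct u ≟ i)

  IsTailShape : List ℕ → List ℕ → Set
  IsTailShape u β = All (Allowed u 0) β × ListAvoids010 (m ∷ β)

  isTailShape? : ∀ u β → Dec (IsTailShape u β)
  isTailShape? u β = all? (allowed? u 0) β ×-dec listAvoids010? (m ∷ β)

  module _ {u : List ℕ} {y : ℕ} where

    Allowed⇒≤ : Allowed u 0 y → y ≤ m
    Allowed⇒≤ (inj₁ refl)           = ≤-refl
    Allowed⇒≤ (inj₂ (_ , y<m , _))  = <⇒≤ y<m

    Allowed⇒∉ : m ∉ u → Allowed u 0 y → y ∉ u
    Allowed⇒∉ m∉u (inj₁ refl)          = m∉u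
    Allowed⇒∉ _   (inj₂ (_ , _ , y∉u)) = y∉u

    ≤∧∉⇒Allowed : y ≤ m → y ∉ u → Allowed u 0 y
    ≤∧∉⇒Allowed y≤m y∉u with y ≟ m
    ... | yes y≡m = inj₁ y≡m
    ... | no y≢m  = inj₂ (z≤n , ≤∧≢⇒< y≤m y≢m , y∉u)

  module _ (u : List ℕ) (m∉u : m ∉ u) (m≤∣u∣ : m ≤ length u) where

    -- Splitting at the first occurrence of m: values before and after it are disjoint, or else y m y occurs.
    InBList-split : ∀ d β → InBList m d (u ++ m ∷ β) ⇔ ((IsPrefix u × IsTailShape u β) × distinct u + distinct (m ∷ β) ≡ d)
    InBList-split d β = mk⇔ to from
      where
      disjoint : (∀ {y} → y ∈ β → y ∉ u) → ∀ {y} → y ∈ u → y ∉ m ∷ β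
      disjoint β∩u=∅ y∈u (here refl)  = m∉u y∈u
      disjoint β∩u=∅ y∈u (there y∈β)  = β∩u=∅ y∈β y∈u

      to : InBList m d (u ++ m ∷ β) → (IsPrefix u × IsTailShape u β) × distinct u + distinct (m ∷ β) ≡ d
      to ((inv , avoids) , (≤m , _) , distinct≡d) =
        (((invᵤ , avoidsᵤ) , u<m) , allowed , avoidsβ) , trans (sym (distinct-++ u (m ∷ β) (disjoint β∩u=∅))) distinct≡d
        where
        invᵤ    = proj₁ (IsInvSeqFrom-++⁻ 0 u (m ∷ β) inv)
        avoidsᵤ = listAvoids010-⊆ (++⁺ʳ (m ∷ β) ⊆-refl) avoids
        avoidsβ = listAvoids010-⊆ (++⁺ˡ u ⊆-refl) avoids
        u<m : All (_< m) u
        u<m = All.tabulate (λ {y} y∈u → ≤∧≢⇒< (All.lookup (All.++⁻ˡ u ≤m) y∈u) (λ { refl → m∉u y∈u }))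
        β≤m : All (_≤ m) β
        β≤m = All.tail (All.++⁻ʳ u ≤m)
        β∩u=∅ : ∀ {y} → y ∈ β → y ∉ u
        β∩u=∅ y∈β y∈u = avoids _ m (All.lookup u<m y∈u) (++⁺ (from∈ y∈u) (refl ∷ from∈ y∈β))
        allowed = All.tabulate (λ y∈β → ≤∧∉⇒Allowed (All.lookup β≤m y∈β) (β∩u=∅ y∈β))

      from : (IsPrefix u × IsTailShape u β) × distinct u + distinct (m ∷ β) ≡ d → InBList m d (u ++ m ∷ β)
      from ((((invᵤ , avoidsᵤ) , u<m) , allowed , avoidsβ) , distinct≡d) =
        (inv , avoids) , (≤m , ∈-++⁺ʳ u (here refl)) , trans (distinct-++ u (m ∷ β) (disjoint β∩u=∅)) distinct≡d
        where
        β≤m : All (_≤ m) β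
        β≤m = All.map Allowed⇒≤ allowed
        β∩u=∅ : ∀ {y} → y ∈ β → y ∉ u
        β∩u=∅ y∈β = Allowed⇒∉ m∉u (All.lookup allowed y∈β)
        inv = IsInvSeqFrom-++⁺ 0 u (m ∷ β) invᵤ
                (m≤∣u∣ , IsInvSeqFrom-≤ (suc (length u)) β (All.map (λ y≤m → m≤n⇒m≤1+n (≤-trans y≤m m≤∣u∣)) β≤m))
        ≤m = All.++⁺ (All.map <⇒≤ u<m) (≤-refl ∷ β≤m)
        avoids : ListAvoids010 (u ++ m ∷ β)
        avoids a b a<b aba⊆ with 010-⊆-++⁻ u aba⊆
        ... | inj₁ aba⊆u                   = avoidsᵤ a b a<b aba⊆u
        ... | inj₂ (inj₁ (a∈u , a∈m∷β))    = disjoint β∩u=∅ a∈u a∈m∷β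
        ... | inj₂ (inj₂ aba⊆m∷β)          = avoidsβ a b a<b aba⊆m∷β

  𝟙-isTail : ∀ u k β → 𝟙 (isTail? u 0 k β) ≡ 𝟙 (isTailShape? u β) * 𝟙 (distinct (m ∷ β) ≟ k)
  𝟙-isTail u k β = trans (𝟙-cong (mk⇔ (λ (allowed , avoids , d≡) → (allowed , avoids) , d≡)
                                     (λ ((allowed , avoids) , d≡) → allowed , avoids , d≡)) _ _)
                         (𝟙-× (isTailShape? u β) (distinct (m ∷ β) ≟ k))

  𝟙-inBList-split : ∀ d u β → m ∉ u → m ≤ length u →
    𝟙 (inBList? m d (u ++ m ∷ β)) ≡ ∑[ i ← upTo d ] (𝟙 (prefix? i u) * 𝟙 (isTail? u 0 (d ∸ i) β))
  𝟙-inBList-split d u β m∉u m≤∣u∣ = sym (begin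
    ∑[ i ← upTo d ] (𝟙 (prefix? i u) * 𝟙 (isTail? u 0 (d ∸ i) β))
      ≡⟨ ∑-cong (upTo d) (λ i → trans (cong₂ _*_ (𝟙-× (isPrefix? u) (distinct u ≟ i)) (𝟙-isTail u (d ∸ i) β))
                                      (*-interchange P (𝟙 (distinct u ≟ i)) Q _)) ⟩
    ∑[ i ← upTo d ] (P * Q * (𝟙 (distinct u ≟ i) * 𝟙 (distinct (m ∷ β) ≟ d ∸ i)))
      ≡⟨ ∑-*ˡ (upTo d) (P * Q) _ ⟩
    P * Q * (∑[ i ← upTo d ] (𝟙 (distinct u ≟ i) * 𝟙 (distinct (m ∷ β) ≟ d ∸ i)))
      ≡⟨ cong (P * Q *_) (∑-cong (upTo d) (λ i → cong (_* 𝟙 (distinct (m ∷ β) ≟ d ∸ i)) (𝟙-cong (mk⇔ sym sym) (distinct u ≟ i) (i ≟ distinct u)))) ⟩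
    P * Q * (∑[ i ← upTo d ] (𝟙 (i ≟ distinct u) * 𝟙 (distinct (m ∷ β) ≟ d ∸ i)))
      ≡⟨ cong (P * Q *_) (∑-δ-∸ d (distinct u) (distinct (m ∷ β)) (1≤distinct-∷ m β)) ⟩
    P * Q * 𝟙 (distinct u + distinct (m ∷ β) ≟ d)
      ≡⟨ trans (𝟙-× (isPrefix? u ×-dec isTailShape? u β) _)
               (cong (_* 𝟙 (distinct u + distinct (m ∷ β) ≟ d)) (𝟙-× (isPrefix? u) (isTailShape? u β))) ⟨
    𝟙 ((isPrefix? u ×-dec isTailShape? u β) ×-dec (distinct u + distinct (m ∷ β) ≟ d))
      ≡⟨ 𝟙-cong (InBList-split u m∉u m≤∣u∣ d β) _ _ ⟨
    𝟙 (inBList? m d (u ++ m ∷ β))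
      ∎)
    where
    open ≡-Reasoning
    P = 𝟙 (isPrefix? u)
    Q = 𝟙 (isTailShape? u β)

  available-prefix : ∀ u i → IsPrefix u × distinct u ≡ i → available u 0 m ≡ m ∸ i
  available-prefix u i ((_ , u<m) , distinct≡i) = trans (∑-∉≡∸distinct m u u<m) (cong (m ∸_) distinct≡i)

  𝟙-prefix≡∑ : ∀ i y ys → 𝟙 (prefix? i (y ∷ ys)) ≡ ∑[ j ← upTo m ] 𝟙 (inBList? j i (y ∷ ys))
  𝟙-prefix≡∑ i y ys with maximum (y ∷ ys) <? m
  ... | yes max<m = sym (trans (∑-inBList-below m i y ys max<m)
                               (𝟙-cong (mk⇔ (λ (A , d≡) → (A , v<m) , d≡) (λ ((A , _) , d≡) → A , d≡)) _ _))
    where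
    v<m : All (_< m) (y ∷ ys)
    v<m = All.map (λ y≤max → ≤-<-trans y≤max max<m) (≤-maximum (y ∷ ys))
  ... | no max≮m = trans (𝟙-no (prefix? i (y ∷ ys)) (λ ((_ , v<m) , _) → max≮m (maximum-< y ys v<m)))
                         (sym (∑-inBList-above m i y ys (≮⇒≥ max≮m)))

  ∑-prefix≡∑b : ∀ a → 1 ≤ a → a ≤ n → ∀ i → ∑[ u ← words a n ] 𝟙 (prefix? i u) ≡ ∑[ j ← upTo m ] b a j i
  ∑-prefix≡∑b a 1≤a a≤n i = begin
    ∑[ u ← words a n ] 𝟙 (prefix? i u)
      ≡⟨ ∑-words-cong a n (λ { [] ∣u∣≡a _ → ⊥-elim (<⇒≢ 1≤a ∣u∣≡a) ; (y ∷ ys) _ _ → 𝟙-prefix≡∑ i y ys }) ⟩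
    ∑[ u ← words a n ] ∑[ j ← upTo m ] 𝟙 (inBList? j i u)
      ≡⟨ ∑-comm (words a n) (upTo m) (λ u j → 𝟙 (inBList? j i u)) ⟩
    ∑[ j ← upTo m ] ∑[ u ← words a n ] 𝟙 (inBList? j i u)
      ≡⟨ ∑-cong (upTo m) (λ j → ∑-words-widen a a n _ a≤n (notInvSeq j)) ⟩
    ∑[ j ← upTo m ] ∑[ u ← words a a ] 𝟙 (inBList? j i u)
      ≡⟨ ∑-cong (upTo m) (λ j → b≡∑words a j i) ⟨
    ∑[ j ← upTo m ] b a j i
      ∎
    where
    open ≡-Reasoning
    notInvSeq : ∀ j u → length u ≡ a → ¬ All (_< a) u → 𝟙 (inBList? j i u) ≡ 0
    notInvSeq j u ∣u∣≡a ¬u<a = 𝟙-no (inBList? j i u)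
      (λ ((inv , _) , _) → ¬u<a (subst (λ k → All (_< k) u) ∣u∣≡a (IsInvSeqFrom⇒< 0 u inv)))

  module _ (d : ℕ) where

    -- The contribution of the sequences whose first m sits at position a (0-indexed).
    firstMaxAt : ℕ → ℕ
    firstMaxAt a = ∑[ u ← words a n ] (𝟙 (¬? (m ∈? u)) * (∑[ β ← words (n ∸ suc a) n ] 𝟙 (inBList? m d (u ++ m ∷ β))))

    firstMaxAt-early : ∀ a → a < m → firstMaxAt a ≡ 0
    firstMaxAt-early a a<m = ∑-words-zero a n (λ u ∣u∣≡a _ →
      trans (cong (𝟙 (¬? (m ∈? u)) *_) (∑-zero (words (n ∸ suc a) n) (λ β → 𝟙-no (inBList? m d (u ++ m ∷ β)) (notInvSeq u β ∣u∣≡a))))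
            (*-zeroʳ (𝟙 (¬? (m ∈? u)))))
      where
      notInvSeq : ∀ u β → length u ≡ a → ¬ InBList m d (u ++ m ∷ β)
      notInvSeq u β ∣u∣≡a ((inv , _) , _) = <⇒≱ a<m (subst (m ≤_) ∣u∣≡a (proj₁ (proj₂ (IsInvSeqFrom-++⁻ 0 u (m ∷ β) inv))))

    firstMaxAt-late : ∀ a → m ≤ a → a < n →
      firstMaxAt a ≡ ∑[ i ← upTo d ] (tailCount (m ∸ i) (n ∸ suc a) (d ∸ i) * (∑[ j ← upTo m ] b a j i))
    firstMaxAt-late a m≤a a<n = begin
      firstMaxAt a
        ≡⟨ ∑-words-cong a n (λ u ∣u∣≡a _ → 𝟙-*-cong (¬? (m ∈? u)) (λ m∉u →
             ∑-cong (words L n) (λ β → 𝟙-inBList-split d u β m∉u (subst (m ≤_) (sym ∣u∣≡a) m≤a)))) ⟩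
      ∑[ u ← words a n ] (𝟙 (¬? (m ∈? u)) * (∑[ β ← words L n ] ∑[ i ← upTo d ] (𝟙 (prefix? i u) * 𝟙 (isTail? u 0 (d ∸ i) β))))
        ≡⟨ ∑-cong (words a n) (λ u → cong (𝟙 (¬? (m ∈? u)) *_) (trans (∑-comm (words L n) (upTo d) _)
             (∑-cong (upTo d) (λ i → ∑-*ˡ (words L n) (𝟙 (prefix? i u)) _)))) ⟩
      ∑[ u ← words a n ] (𝟙 (¬? (m ∈? u)) * (∑[ i ← upTo d ] (𝟙 (prefix? i u) * tails u 0 L (d ∸ i))))
        ≡⟨ ∑-cong (words a n) (λ u → cong (𝟙 (¬? (m ∈? u)) *_) (∑-cong (upTo d) (λ i → 𝟙-*-cong (prefix? i u) (λ prefix →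
             trans (tails≡tailCount u m 0 refl L (d ∸ i)) (cong (λ t → tailCount t L (d ∸ i)) (available-prefix u i prefix)))))) ⟩
      ∑[ u ← words a n ] (𝟙 (¬? (m ∈? u)) * (∑[ i ← upTo d ] (𝟙 (prefix? i u) * tailCount (m ∸ i) L (d ∸ i))))
        ≡⟨ ∑-cong (words a n) (λ u → m∉prefix u (λ i → tailCount (m ∸ i) L (d ∸ i))) ⟩
      ∑[ u ← words a n ] ∑[ i ← upTo d ] (𝟙 (prefix? i u) * tailCount (m ∸ i) L (d ∸ i))
        ≡⟨ ∑-comm (words a n) (upTo d) _ ⟩
      ∑[ i ← upTo d ] ∑[ u ← words a n ] (𝟙 (prefix? i u) * tailCount (m ∸ i) L (d ∸ i))
        ≡⟨ ∑-cong (upTo d) (λ i → trans (∑-*ʳ (words a n) _ _) (trans (*-comm _ (tailCount (m ∸ i) L (d ∸ i)))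
             (cong (tailCount (m ∸ i) L (d ∸ i) *_) (∑-prefix≡∑b a (≤-trans 1≤m m≤a) (<⇒≤ a<n) i)))) ⟩
      ∑[ i ← upTo d ] (tailCount (m ∸ i) L (d ∸ i) * (∑[ j ← upTo m ] b a j i))
        ∎
      where
      open ≡-Reasoning
      L = n ∸ suc a
      m∉prefix : ∀ u (X : ℕ → ℕ) →
                 𝟙 (¬? (m ∈? u)) * (∑[ i ← upTo d ] (𝟙 (prefix? i u) * X i)) ≡ ∑[ i ← upTo d ] (𝟙 (prefix? i u) * X i)
      m∉prefix u X with m ∈? u
      ... | no _    = *-identityˡ _
      ... | yes m∈u = sym (∑-zero (upTo d) (λ i → cong (_* X i) (𝟙-no (prefix? i u) (λ ((_ , u<m) , _) → <-irrefl refl (All.lookup u<m m∈u)))))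

    b≡∑firstMaxAt : b n m d ≡ ∑[ t ← upTo (n ∸ m) ] firstMaxAt (m + t)
    b≡∑firstMaxAt = begin
      b n m d                                                       ≡⟨ b≡∑words n m d ⟩
      ∑[ v ← words n n ] 𝟙 (inBList? m d v)                          ≡⟨ ∑-cong (words n n) containsMax ⟩
      ∑[ v ← words n n ] (𝟙 (m ∈? v) * 𝟙 (inBList? m d v))           ≡⟨ ∑-words-firstOccurrence m<n n _ ⟩
      ∑ (upTo n) firstMaxAt                                         ≡⟨ cong (λ k → ∑ (upTo k) firstMaxAt) (m+[n∸m]≡n (<⇒≤ m<n)) ⟨
      ∑ (upTo (m + (n ∸ m))) firstMaxAt                             ≡⟨ ∑-upTo-+ m (n ∸ m) firstMaxAt ⟩
      ∑ (upTo m) firstMaxAt + (∑[ t ← upTo (n ∸ m) ] firstMaxAt (m + t))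
        ≡⟨ cong (_+ (∑[ t ← upTo (n ∸ m) ] firstMaxAt (m + t))) (∑-zero-∈ (upTo m) (λ a a∈ → firstMaxAt-early a (∈-upTo⁻ a∈))) ⟩
      ∑[ t ← upTo (n ∸ m) ] firstMaxAt (m + t)                      ∎
      where
      open ≡-Reasoning
      containsMax : ∀ v → 𝟙 (inBList? m d v) ≡ 𝟙 (m ∈? v) * 𝟙 (inBList? m d v)
      containsMax v with inBList? m d v
      ... | yes (_ , (_ , m∈v) , _) = sym (cong (_* 1) (𝟙-yes (m ∈? v) m∈v))
      ... | no _                    = sym (*-zeroʳ (𝟙 (m ∈? v)))

-- The recurrence

tailCount-reindex : ∀ n p m d i → p ≤ n → i ≤ d →
  tailCount (m ∸ i) (n ∸ p) (d ∸ i) ≡ ((m ∸ i) C (d ∸ suc i)) * stirling1 (n ∸ p + 1) ((n + i + 2) ∸ (p + d))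
tailCount-reindex n p m d i p≤n i≤d = cong₂ (λ k s → ((m ∸ i) C k) * s) d∸i∸1≡ (cong₂ stirling1 (+-comm 1 (n ∸ p)) 2+L∸k≡)
  where
  open ≡-Reasoning
  L = n ∸ p
  k = d ∸ i
  d∸i∸1≡ : d ∸ i ∸ 1 ≡ d ∸ suc i
  d∸i∸1≡ = trans (∸-+-assoc d i 1) (cong (d ∸_) (+-comm i 1))
  2+L∸k≡ : (2 + L) ∸ k ≡ (n + i + 2) ∸ (p + d)
  2+L∸k≡ = sym (begin
    (n + i + 2) ∸ (p + d)                ≡⟨ cong₂ (λ n′ d′ → n′ + i + 2 ∸ (p + d′)) (m+[n∸m]≡n p≤n) (m+[n∸m]≡n i≤d) ⟨
    (p + L) + i + 2 ∸ (p + (i + k))      ≡⟨ cong₂ _∸_ (rearrange p L i) (+-assoc p i k) ⟨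
    ((p + i) + (2 + L)) ∸ ((p + i) + k)  ≡⟨ [m+n]∸[m+o]≡n∸o (p + i) (2 + L) k ⟩
    (2 + L) ∸ k                          ∎)
    where
    rearrange : ∀ p L i → (p + i) + (2 + L) ≡ (p + L) + i + 2
    rearrange = solve 3 (λ p L i → (p :+ i) :+ (con 2 :+ L) := (p :+ L) :+ i :+ con 2) refl
      where open +-*-Solver

-- The i-th summand of the recurrence; p is the 1-indexed position of the first occurrence of m.
recurrenceTerm : ℕ → ℕ → ℕ → ℕ → ℕ
recurrenceTerm n m d i = ((m ∸ i) C (d ∸ suc i))
  * sumFromTo (suc m) n (λ p → stirling1 (n ∸ p + 1) ((n + i + 2) ∸ (p + d)) * sumLt m (λ j → b (p ∸ 1) j i))

b≡recurrence : ∀ n m d → 1 ≤ m → b n m d ≡ sumLt d (recurrenceTerm n m d)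
b≡recurrence n m d 1≤m with m <? n
... | yes m<n = begin
  b n m d
    ≡⟨ b≡∑firstMaxAt d ⟩
  ∑[ t ← upTo (n ∸ m) ] firstMaxAt d (m + t)
    ≡⟨ ∑-cong-∈ (upTo (n ∸ m)) (λ t t∈ → firstMaxAt-late d (m + t) (m≤m+n m t) (p≤n t t∈)) ⟩
  ∑[ t ← upTo (n ∸ m) ] ∑[ i ← upTo d ] (tailCount (m ∸ i) (n ∸ suc (m + t)) (d ∸ i) * B t i)
    ≡⟨ ∑-comm (upTo (n ∸ m)) (upTo d) _ ⟩
  ∑[ i ← upTo d ] ∑[ t ← upTo (n ∸ m) ] (tailCount (m ∸ i) (n ∸ suc (m + t)) (d ∸ i) * B t i)
    ≡⟨ ∑-cong-∈ (upTo d) (λ i i∈ → trans (∑-cong-∈ (upTo (n ∸ m)) (λ t t∈ →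
         trans (cong (_* B t i) (tailCount-reindex n (suc (m + t)) m d i (p≤n t t∈) (<⇒≤ (∈-upTo⁻ i∈))))
               (*-assoc ((m ∸ i) C (d ∸ suc i)) _ (B t i))))
         (∑-*ˡ (upTo (n ∸ m)) ((m ∸ i) C (d ∸ suc i)) _)) ⟩
  sumLt d (recurrenceTerm n m d)
    ∎
  where
  open ≡-Reasoning
  open Decomposition n m m<n 1≤m
  B : ℕ → ℕ → ℕ
  B t i = ∑[ j ← upTo m ] b (m + t) j i
  p≤n : ∀ t → t ∈ upTo (n ∸ m) → suc (m + t) ≤ n
  p≤n t t∈ = subst (suc (m + t) ≤_) (m+[n∸m]≡n (<⇒≤ m<n)) (+-monoʳ-< m (∈-upTo⁻ t∈))
... | no m≮n = begin
  b n m d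
    ≡⟨ b≡∑words n m d ⟩
  ∑[ v ← words n n ] 𝟙 (inBList? m d v)
    ≡⟨ ∑-words-zero n n (λ v _ v<n → 𝟙-no (inBList? m d v) (λ (_ , (_ , m∈v) , _) → m≮n (All.lookup v<n m∈v))) ⟩
  0
    ≡⟨ ∑-zero (upTo d) emptyRange ⟨
  sumLt d (recurrenceTerm n m d)
    ∎
  where
  open ≡-Reasoning
  emptyRange : ∀ i → recurrenceTerm n m d i ≡ 0
  emptyRange i rewrite m≤n⇒m∸n≡0 (≮⇒≥ m≮n) = *-zeroʳ ((m ∸ i) C (d ∸ suc i))

theorem1 : ((n : ℕ) → 1 ≤ n →
             avoidCount n ≡ sumFromTo 0 (n ∸ 1) (λ m → sumFromTo 0 n (λ d → b n m d)))
           × ((n m d : ℕ) → 1 ≤ m →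
             b n m d ≡ sumLt d (λ i → ((m ∸ i) C (d ∸ suc i))
               * sumFromTo (suc m) n (λ p → stirling1 (n ∸ p + 1) ((n + i + 2) ∸ (p + d))
                 * sumLt m (λ j → b (p ∸ 1) j i))))
theorem1 = avoidCount≡∑∑b , b≡recurrence
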